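{- Let $n\ge1$ and $u,v\ge 0$ be integers, and let $d_1>d_2>\dots>d_n\ge0$ be integers. Then $\alpha^{(n,u,v)}_{d_1,\dots,d_n}\ge 0$.
   Context: For integers $n\ge1$ and $u,v\ge0$ define the integer polynomial $$Q^{(n,u,v)}(x_1,\dots,x_n)=\sum_{\pi\in S_n}\operatorname{sgn}(\pi)\left(\prod_{\ell=1}^{n-1}\big(x_{\pi(1)}+\dots+x_{\pi(\ell)}\big)^u\right)(x_1+\dots+x_n)^v,$$ where $S_n$ is the symmetric group on $\{1,\dots,n\}$; for $n=1$ (empty product) this means $Q^{(1,u,v)}(x_1)=x_1^v$. For integers $d_1\ge d_2\ge\dots\ge d_n\ge 0$, $\alpha^{(n,u,v)}_{d_1,\dots,d_n}$ denotes the coefficient of the monomial $x_1^{d_1}\cdots x_n^{d_n}$ in $Q^{(n,u,v)}$. -}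

module Defs where

open import Data.Nat as ℕ using (ℕ; zero; suc; _∸_)
open import Data.Integer as ℤ using (ℤ; +_; -1ℤ; 0ℤ; 1ℤ)
open import Data.Fin as Fin using (Fin; toℕ)
open import Data.Vec as Vec using (Vec; replicate; zipWith; updateAt; lookup)
open import Data.List as List using (List; []; _∷_; _++_; map; concatMap; foldr; take; upTo; allFin; length)
open import Data.Product using (_×_; _,_)
open import Data.Bool using (if_then_else_)
open import Relation.Nullary.Decidable using (⌊_⌋)
open import Data.Vec.Properties using (≡-dec)

-- A polynomial in n variables with integer coefficients, represented as a
-- formal (not necessarily reduced) sum of terms  c * x^e  with e ∈ ℕ^n.
Poly : ℕ → Set
Poly n = List (ℤ × Vec ℕ n)

_+P_ : ∀ {n} → Poly n → Poly n → Poly n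
p +P q = p ++ q

_*P_ : ∀ {n} → Poly n → Poly n → Poly n
p *P q = concatMap (λ { (a , e) → map (λ { (b , f) → (a ℤ.* b , zipWith ℕ._+_ e f) }) q }) p

constP : ∀ {n} → ℤ → Poly n
constP c = (c , replicate _ 0) ∷ []

1P : ∀ {n} → Poly n
1P = constP 1ℤ

scaleP : ∀ {n} → ℤ → Poly n → Poly n
scaleP c p = constP c *P p

_^P_ : ∀ {n} → Poly n → ℕ → Poly n
p ^P zero  = 1P
p ^P suc k = p *P (p ^P k)

sumP : ∀ {n} → List (Poly n) → Poly n
sumP = foldr _+P_ []

prodP : ∀ {n} → List (Poly n) → Poly n
prodP = foldr _*P_ 1P

var : ∀ {n} → Fin n → Poly n
var i = (1ℤ , updateAt (replicate _ 0) i (λ _ → 1)) ∷ []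

coeff : ∀ {n} → Vec ℕ n → Poly n → ℤ
coeff d p = foldr (λ { (c , e) acc → if ⌊ ≡-dec ℕ._≟_ e d ⌋ then c ℤ.+ acc else acc }) 0ℤ p

insertions : ∀ {A : Set} → A → List A → List (List A)
insertions x [] = (x ∷ []) ∷ []
insertions x (y ∷ ys) = (x ∷ y ∷ ys) ∷ map (y ∷_) (insertions x ys)

perms : ∀ {A : Set} → List A → List (List A)
perms [] = [] ∷ []
perms (x ∷ xs) = concatMap (insertions x) (perms xs)

-- S_n, each permutation π given as the word [π(1), …, π(n)]
Sym : (n : ℕ) → List (List (Fin n))
Sym n = perms (allFin n)

inversions : ∀ {n} → List (Fin n) → ℕ
inversions [] = 0
inversions (x ∷ xs) = List.length (List.filter (λ y → y Fin.<? x) xs) ℕ.+ inversions xs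

sgn : ∀ {n} → List (Fin n) → ℤ
sgn π = -1ℤ ℤ.^ inversions π

linSum : ∀ {n} → List (Fin n) → Poly n
linSum w = sumP (map var w)

Q : (n u v : ℕ) → Poly n
Q n u v = sumP (map term (Sym n))
  where
  term : List (Fin n) → Poly n
  term π = scaleP (sgn π)
             (prodP (map (λ ℓ → linSum (take ℓ π) ^P u) (map suc (upTo (n ∸ 1))))
               *P (linSum (allFin n) ^P v))

α : (n u v : ℕ) → Vec ℕ n → ℤ
α n u v d = coeff d (Q n u v)

-- Coefficients are read through ⟦ p ⟧ d, defined for all d ∈ ℤ^n, so that
-- multiplying by x_j becomes the shift d ↦ d - e_j; coeffQ n u v d = ⟦ Q ⟧ d.
--   (1) Shift recurrence: coeffQ n u (v+1) d = Σ_j coeffQ n u v (d - e_j).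
--   (2) Alternation: coeffQ n u v d = 0 if d_j = d_{j+1}, since swapping the
--       variables j, j+1 flips every sign while fixing d.
--   (3) Peeling the last variable (n ≥ 2, d decreasing, v = 0): the summand of
--       π avoids x_{π n}, so only π with π n = n contribute; hence coeffQ is 0
--       unless d_n = 0, and coeffQ n u 0 (d',0) = coeffQ (n-1) u u d'.
-- If d is strictly decreasing, each d - e_j is weakly decreasing, so either
-- decreasing (induction on v) or covered by (2); at v = 0 we use (3) and
-- induction on n, ending at n = 1 where Q = 1.  The file develops finite sums,
-- the coefficient functional, Q and (1), signs and (2), appended letters and
-- (3), and finally the induction.
module Submission where

open import Defs
open import Data.Nat as ℕ using (ℕ; zero; suc; _≥_; _<_; _∸_)
open import Data.Integer as ℤ using (ℤ; +_; -1ℤ; 0ℤ; 1ℤ; _+_; _*_; -_; _-_) renaming (_≤_ to _≤ℤ_)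
import Data.Integer.Properties as ZP
import Data.Nat.Properties as NP
open import Data.Integer.Tactic.RingSolver using (solve-∀)
import Data.Nat.Tactic.RingSolver as NS
open import Data.Fin as F using (Fin; toℕ) renaming (_<_ to _<F_)
open import Data.Vec as V using (Vec; lookup; []; _∷_; zipWith; replicate; updateAt)
import Data.Vec.Properties as VP
open import Data.Vec.Properties using (≡-dec)
open import Data.List as L using (List; []; _∷_; _++_; concatMap; take; upTo; allFin; length; [_]; _∷ʳ_)
import Data.List.Relation.Unary.All.Properties as AP
import Data.List.Properties as LP
open import Data.List.Relation.Binary.Permutation.Propositional as Perm using (_↭_; prep; swap; ↭-sym)
import Data.List.Relation.Binary.Permutation.Propositional.Properties as PermP
open import Data.Unit using (⊤; tt)
open import Relation.Binary.Definitions using (tri<; tri≈; tri>)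
open import Data.Product using (_×_; _,_; proj₁; proj₂; ∃)
open import Data.Bool using (if_then_else_)
open import Relation.Nullary.Decidable using (⌊_⌋; yes; no)
open import Relation.Nullary using (¬_; Dec)
import Data.Fin.Properties as FP
open import Data.Sum using (_⊎_; inj₁; inj₂)
open import Relation.Binary.PropositionalEquality hiding ([_])
open import Function using (_∘_; id)
open import Data.Empty using (⊥-elim)
open import Data.List.Relation.Unary.All as All using (All; []; _∷_)

Σl : ∀ {A : Set} → List A → (A → ℤ) → ℤ
Σl [] f = 0ℤ
Σl (x ∷ xs) f = f x + Σl xs f

Σ-++ : ∀ {A : Set} (xs ys : List A) (f : A → ℤ) → Σl (xs ++ ys) f ≡ Σl xs f + Σl ys f
Σ-++ [] ys f = sym (ZP.+-identityˡ _)
Σ-++ (x ∷ xs) ys f = trans (cong (λ z → f x + z) (Σ-++ xs ys f)) (sym (ZP.+-assoc (f x) _ _))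

Σ-map : ∀ {A B : Set} (g : A → B) (xs : List A) (f : B → ℤ) → Σl (L.map g xs) f ≡ Σl xs (f ∘ g)
Σ-map g [] f = refl
Σ-map g (x ∷ xs) f = cong (λ z → f (g x) + z) (Σ-map g xs f)

Σ-concatMap : ∀ {A B : Set} (g : A → List B) (xs : List A) (f : B → ℤ) →
  Σl (concatMap g xs) f ≡ Σl xs (λ x → Σl (g x) f)
Σ-concatMap g [] f = refl
Σ-concatMap g (x ∷ xs) f = trans (Σ-++ (g x) _ f) (cong (λ z → Σl (g x) f + z) (Σ-concatMap g xs f))

Σ-cong : ∀ {A : Set} (xs : List A) {f g : A → ℤ} → (∀ x → f x ≡ g x) → Σl xs f ≡ Σl xs g
Σ-cong [] h = refl
Σ-cong (x ∷ xs) h = cong₂ _+_ (h x) (Σ-cong xs h)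

Σ-+ : ∀ {A : Set} (xs : List A) (f g : A → ℤ) → Σl xs (λ x → f x + g x) ≡ Σl xs f + Σl xs g
Σ-+ [] f g = refl
Σ-+ (x ∷ xs) f g = trans (cong (λ z → (f x + g x) + z) (Σ-+ xs f g)) (rearrange (f x) (g x) (Σl xs f) (Σl xs g))
  where rearrange : ∀ a b c d → (a + b) + (c + d) ≡ (a + c) + (b + d)
        rearrange = solve-∀

Σ-* : ∀ {A : Set} (c : ℤ) (xs : List A) (f : A → ℤ) → Σl xs (λ x → c * f x) ≡ c * Σl xs f
Σ-* c [] f = sym (ZP.*-zeroʳ c)
Σ-* c (x ∷ xs) f = trans (cong (λ z → c * f x + z) (Σ-* c xs f)) (sym (ZP.*-distribˡ-+ c (f x) _))

Σ-neg : ∀ {A : Set} (xs : List A) (f : A → ℤ) → Σl xs (λ x → - f x) ≡ - Σl xs f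
Σ-neg [] f = refl
Σ-neg (x ∷ xs) f = trans (cong (λ z → - f x + z) (Σ-neg xs f)) (sym (ZP.neg-distrib-+ (f x) _))

Σ-0 : ∀ {A : Set} (xs : List A) {f : A → ℤ} → (∀ x → f x ≡ 0ℤ) → Σl xs f ≡ 0ℤ
Σ-0 [] h = refl
Σ-0 (x ∷ xs) h = trans (cong₂ _+_ (h x) (Σ-0 xs h)) refl

Σ-swap : ∀ {A B : Set} (xs : List A) (ys : List B) (f : A → B → ℤ) →
  Σl xs (λ x → Σl ys (λ y → f x y)) ≡ Σl ys (λ y → Σl xs (λ x → f x y))
Σ-swap [] ys f = sym (Σ-0 ys (λ _ → refl))
Σ-swap (x ∷ xs) ys f = trans (cong (λ z → Σl ys (f x) + z) (Σ-swap xs ys f))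
  (sym (Σ-+ ys (f x) (λ y → Σl xs (λ x' → f x' y))))

Σ-↭ : ∀ {A : Set} {xs ys : List A} (f : A → ℤ) → xs ↭ ys → Σl xs f ≡ Σl ys f
Σ-↭ f Perm.refl = refl
Σ-↭ f (prep x p) = cong (λ z → f x + z) (Σ-↭ f p)
Σ-↭ f (swap x y p) = trans (cong (λ z → f x + (f y + z)) (Σ-↭ f p)) (rearrange (f x) (f y) _)
  where rearrange : ∀ a b c → a + (b + c) ≡ b + (a + c)
        rearrange = solve-∀
Σ-↭ f (Perm.trans p q) = trans (Σ-↭ f p) (Σ-↭ f q)

Σ-nonneg : ∀ {A : Set} (xs : List A) (f : A → ℤ) → (∀ x → + 0 ≤ℤ f x) → + 0 ≤ℤ Σl xs f
Σ-nonneg [] f h = ZP.≤-refl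
Σ-nonneg (x ∷ xs) f h = ZP.+-mono-≤ (h x) (Σ-nonneg xs f h)

-- Exponent vectors are embedded in ℤ^n so that they can be shifted freely.
toZ : ∀ {n} → Vec ℕ n → Vec ℤ n
toZ = V.map (λ k → + k)

_⊖_ : ∀ {n} → Vec ℤ n → Vec ℤ n → Vec ℤ n
d ⊖ e = zipWith _-_ d e

δ : ∀ {n} → Vec ℤ n → Vec ℤ n → ℤ
δ x y = if ⌊ ≡-dec ℤ._≟_ x y ⌋ then 1ℤ else 0ℤ

δ-resp : ∀ {n m} (x y : Vec ℤ n) (x' y' : Vec ℤ m) → (x ≡ y → x' ≡ y') → (x' ≡ y' → x ≡ y) → δ x y ≡ δ x' y'
δ-resp x y x' y' f g with ≡-dec ℤ._≟_ x y | ≡-dec ℤ._≟_ x' y'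
... | yes p | yes q = refl
... | yes p | no q = ⊥-elim (q (f p))
... | no p | yes q = ⊥-elim (p (g q))
... | no p | no q = refl

δ-nonneg : ∀ {n} (x y : Vec ℤ n) → + 0 ≤ℤ δ x y
δ-nonneg x y with ≡-dec ℤ._≟_ x y
... | yes _ = ℤ.+≤+ ℕ.z≤n
... | no _ = ZP.≤-refl

-- ⟦ p ⟧ d is the coefficient of x^d in p, for any d ∈ ℤ^n (0 off ℕ^n).
termAt : ∀ {n} → Vec ℤ n → ℤ × Vec ℕ n → ℤ
termAt d t = proj₁ t * δ (toZ (proj₂ t)) d

⟦_⟧ : ∀ {n} → Poly n → Vec ℤ n → ℤ
⟦ p ⟧ d = Σl p (termAt d)

toZ-inj : ∀ {n} (e f : Vec ℕ n) → toZ e ≡ toZ f → e ≡ f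
toZ-inj [] [] h = refl
toZ-inj (x ∷ e) (y ∷ f) h = cong₂ _∷_ (ZP.+-injective (VP.∷-injectiveˡ h)) (toZ-inj e f (VP.∷-injectiveʳ h))

coeff≡ : ∀ {n} (d : Vec ℕ n) (p : Poly n) → coeff d p ≡ ⟦ p ⟧ (toZ d)
coeff≡ d [] = refl
coeff≡ d ((c , e) ∷ p) with ≡-dec ℕ._≟_ e d | ≡-dec ℤ._≟_ (toZ e) (toZ d)
... | yes q | yes r = cong₂ _+_ (sym (ZP.*-identityʳ c)) (coeff≡ d p)
... | yes q | no r = ⊥-elim (r (cong toZ q))
... | no q | yes r = ⊥-elim (q (toZ-inj e d r))
... | no q | no r = trans (coeff≡ d p) (sym (trans (cong (_+ ⟦ p ⟧ (toZ d)) (ZP.*-zeroʳ c)) (ZP.+-identityˡ _)))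

toZ-zip : ∀ {n} (e f : Vec ℕ n) → toZ (zipWith ℕ._+_ e f) ≡ zipWith _+_ (toZ e) (toZ f)
toZ-zip [] [] = refl
toZ-zip (x ∷ e) (y ∷ f) = cong (_ ∷_) (toZ-zip e f)

shift→ : ∀ {n} (x y z : Vec ℤ n) → zipWith _+_ x y ≡ z → y ≡ z ⊖ x
shift→ [] [] [] h = refl
shift→ (a ∷ x) (b ∷ y) (c ∷ z) h = cong₂ _∷_ (trans (rearrange a b) (cong (_- a) (VP.∷-injectiveˡ h))) (shift→ x y z (VP.∷-injectiveʳ h))
  where rearrange : ∀ a b → b ≡ (a + b) - a
        rearrange = solve-∀

shift← : ∀ {n} (x y z : Vec ℤ n) → y ≡ z ⊖ x → zipWith _+_ x y ≡ z
shift← [] [] [] h = refl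
shift← (a ∷ x) (b ∷ y) (c ∷ z) h = cong₂ _∷_ (trans (cong (λ z → a + z) (VP.∷-injectiveˡ h)) (rearrange a c)) (shift← x y z (VP.∷-injectiveʳ h))
  where rearrange : ∀ a c → a + (c - a) ≡ c
        rearrange = solve-∀

δ-shift : ∀ {n} (e f : Vec ℕ n) (d : Vec ℤ n) → δ (toZ (zipWith ℕ._+_ e f)) d ≡ δ (toZ f) (d ⊖ toZ e)
δ-shift e f d = δ-resp _ _ _ _
  (λ h → shift→ (toZ e) (toZ f) d (trans (sym (toZ-zip e f)) h))
  (λ h → trans (toZ-zip e f) (shift← (toZ e) (toZ f) d h))

⊖-zip : ∀ {n} (d : Vec ℤ n) (e f : Vec ℕ n) → d ⊖ toZ (zipWith ℕ._+_ e f) ≡ (d ⊖ toZ e) ⊖ toZ f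
⊖-zip [] [] [] = refl
⊖-zip (a ∷ d) (x ∷ e) (y ∷ f) = cong₂ _∷_ (rearrange a (+ x) (+ y)) (⊖-zip d e f)
  where rearrange : ∀ a x y → a - (x + y) ≡ (a - x) - y
        rearrange = solve-∀

⊖-comm : ∀ {n} (d a b : Vec ℤ n) → (d ⊖ a) ⊖ b ≡ (d ⊖ b) ⊖ a
⊖-comm [] [] [] = refl
⊖-comm (x ∷ d) (y ∷ a) (z ∷ b) = cong₂ _∷_ (rearrange x y z) (⊖-comm d a b)
  where rearrange : ∀ x y z → (x - y) - z ≡ (x - z) - y
        rearrange = solve-∀

⊖-0 : ∀ {n} (d : Vec ℤ n) → d ⊖ toZ (replicate n 0) ≡ d
⊖-0 [] = refl
⊖-0 (x ∷ d) = cong₂ _∷_ (ZP.+-identityʳ x) (⊖-0 d)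

Σ-*P : ∀ {n} (p q : Poly n) (F : ℤ × Vec ℕ n → ℤ) →
  Σl (p *P q) F ≡ Σl p (λ t → Σl q (λ s → F (proj₁ t * proj₁ s , zipWith ℕ._+_ (proj₂ t) (proj₂ s))))
Σ-*P [] q F = refl
Σ-*P ((a , e) ∷ p) q F = trans (Σ-++ (L.map g q) (p *P q) F) (cong₂ _+_ (Σ-map g q F) (Σ-*P p q F))
  where g : ℤ × Vec ℕ _ → ℤ × Vec ℕ _
        g s = (a * proj₁ s , zipWith ℕ._+_ e (proj₂ s))

⟦*P⟧ˡ : ∀ {n} (p q : Poly n) (d : Vec ℤ n) → ⟦ p *P q ⟧ d ≡ Σl p (λ t → proj₁ t * ⟦ q ⟧ (d ⊖ toZ (proj₂ t)))
⟦*P⟧ˡ p q d = trans (Σ-*P p q (termAt d)) (Σ-cong p λ t →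
  trans (Σ-cong q (λ s → trans (cong (proj₁ t * proj₁ s *_) (δ-shift (proj₂ t) (proj₂ s) d)) (ZP.*-assoc (proj₁ t) _ _)))
        (Σ-* (proj₁ t) q _))

⟦*P⟧ʳ : ∀ {n} (p q : Poly n) (d : Vec ℤ n) → ⟦ p *P q ⟧ d ≡ Σl q (λ s → proj₁ s * ⟦ p ⟧ (d ⊖ toZ (proj₂ s)))
⟦*P⟧ʳ p q d = trans (Σ-*P p q (termAt d)) (trans (Σ-swap p q _) (Σ-cong q λ s →
  trans (Σ-cong p (λ t → trans (cong₂ _*_ (ZP.*-comm (proj₁ t) (proj₁ s))
            (trans (cong (λ v → δ (toZ v) d) (VP.zipWith-comm NP.+-comm (proj₂ t) (proj₂ s))) (δ-shift (proj₂ s) (proj₂ t) d)))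
          (ZP.*-assoc (proj₁ s) _ _)))
        (Σ-* (proj₁ s) p _)))

-- Polynomials with the same coefficients; the formal sums of Defs are not
-- normalised, so ring laws only hold up to this relation.
_≈_ : ∀ {n} → Poly n → Poly n → Set
p ≈ q = ∀ d → ⟦ p ⟧ d ≡ ⟦ q ⟧ d

*-congʳ : ∀ {n} (p : Poly n) {q q' : Poly n} → q ≈ q' → (p *P q) ≈ (p *P q')
*-congʳ p {q} {q'} h d = trans (⟦*P⟧ˡ p q d) (trans (Σ-cong p (λ t → cong (proj₁ t *_) (h (d ⊖ toZ (proj₂ t))))) (sym (⟦*P⟧ˡ p q' d)))

*-assoc : ∀ {n} (p q r : Poly n) → ((p *P q) *P r) ≈ (p *P (q *P r))
*-assoc p q r d = begin
  ⟦ (p *P q) *P r ⟧ d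
    ≡⟨ ⟦*P⟧ˡ (p *P q) r d ⟩
  Σl (p *P q) (λ t → proj₁ t * ⟦ r ⟧ (d ⊖ toZ (proj₂ t)))
    ≡⟨ Σ-*P p q _ ⟩
  Σl p (λ t → Σl q (λ s → proj₁ t * proj₁ s * ⟦ r ⟧ (d ⊖ toZ (zipWith ℕ._+_ (proj₂ t) (proj₂ s)))))
    ≡⟨ Σ-cong p (λ t → Σ-cong q (λ s → trans (ZP.*-assoc (proj₁ t) (proj₁ s) _)
         (cong (λ z → proj₁ t * (proj₁ s * ⟦ r ⟧ z)) (⊖-zip d (proj₂ t) (proj₂ s))))) ⟩
  Σl p (λ t → Σl q (λ s → proj₁ t * (proj₁ s * ⟦ r ⟧ ((d ⊖ toZ (proj₂ t)) ⊖ toZ (proj₂ s)))))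
    ≡⟨ Σ-cong p (λ t → trans (Σ-* (proj₁ t) q _) (cong (proj₁ t *_) (sym (⟦*P⟧ˡ q r _)))) ⟩
  Σl p (λ t → proj₁ t * ⟦ q *P r ⟧ (d ⊖ toZ (proj₂ t)))
    ≡⟨ sym (⟦*P⟧ˡ p (q *P r) d) ⟩
  ⟦ p *P (q *P r) ⟧ d ∎
  where open ≡-Reasoning

*-unitˡ : ∀ {n} (p : Poly n) → (1P *P p) ≈ p
*-unitˡ {n} p d = trans (⟦*P⟧ˡ 1P p d) (trans (ZP.+-identityʳ _) (trans (ZP.*-identityˡ _) (cong ⟦ p ⟧ (⊖-0 d))))

*-unitʳ : ∀ {n} (p : Poly n) → (p *P 1P) ≈ p
*-unitʳ {n} p d = trans (⟦*P⟧ʳ p 1P d) (trans (ZP.+-identityʳ _) (trans (ZP.*-identityˡ _) (cong ⟦ p ⟧ (⊖-0 d))))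

prodP-∷ʳ : ∀ {n} (xs : List (Poly n)) y → prodP (xs ∷ʳ y) ≈ (prodP xs *P y)
prodP-∷ʳ [] y d = trans (*-unitʳ y d) (sym (*-unitˡ y d))
prodP-∷ʳ (x ∷ xs) y d = trans (*-congʳ x (prodP-∷ʳ xs y) d) (sym (*-assoc x (prodP xs) y d))

⟦scale⟧ : ∀ {n} (c : ℤ) (p : Poly n) (d : Vec ℤ n) → ⟦ scaleP c p ⟧ d ≡ c * ⟦ p ⟧ d
⟦scale⟧ c p d = trans (⟦*P⟧ˡ (constP c) p d) (trans (ZP.+-identityʳ _) (cong (c *_) (cong ⟦ p ⟧ (⊖-0 d))))

⟦++⟧ : ∀ {n} (p q : Poly n) (d : Vec ℤ n) → ⟦ p ++ q ⟧ d ≡ ⟦ p ⟧ d + ⟦ q ⟧ d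
⟦++⟧ p q d = Σ-++ p q (termAt d)

⟦sumP⟧ : ∀ {n} (ps : List (Poly n)) (d : Vec ℤ n) → ⟦ sumP ps ⟧ d ≡ Σl ps (λ p → ⟦ p ⟧ d)
⟦sumP⟧ [] d = refl
⟦sumP⟧ (p ∷ ps) d = trans (⟦++⟧ p (sumP ps) d) (cong (λ z → ⟦ p ⟧ d + z) (⟦sumP⟧ ps d))

unitV : ∀ {n} → Fin n → Vec ℕ n
unitV i = updateAt (replicate _ 0) i (λ _ → 1)

ê : ∀ {n} → Fin n → Vec ℤ n
ê i = toZ (unitV i)

linSum≡ : ∀ {n} (w : List (Fin n)) → linSum w ≡ L.map (λ i → (1ℤ , unitV i)) w
linSum≡ [] = refl
linSum≡ (i ∷ w) = cong (_ ∷_) (linSum≡ w)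

⟦L*⟧ : ∀ {n} (w : List (Fin n)) (q : Poly n) (d : Vec ℤ n) → ⟦ linSum w *P q ⟧ d ≡ Σl w (λ i → ⟦ q ⟧ (d ⊖ ê i))
⟦L*⟧ w q d = trans (⟦*P⟧ˡ (linSum w) q d) (trans (cong (λ z → Σl z (λ t → proj₁ t * ⟦ q ⟧ (d ⊖ toZ (proj₂ t)))) (linSum≡ w))
  (trans (Σ-map _ w _) (Σ-cong w (λ i → ZP.*-identityˡ _))))

⟦*L*⟧ : ∀ {n} (p : Poly n) (w : List (Fin n)) (q : Poly n) (d : Vec ℤ n) →
        ⟦ p *P (linSum w *P q) ⟧ d ≡ Σl w (λ i → ⟦ p *P q ⟧ (d ⊖ ê i))
⟦*L*⟧ p w q d = begin
  ⟦ p *P (linSum w *P q) ⟧ d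
    ≡⟨ ⟦*P⟧ˡ p _ d ⟩
  Σl p (λ t → proj₁ t * ⟦ linSum w *P q ⟧ (d ⊖ toZ (proj₂ t)))
    ≡⟨ Σ-cong p (λ t → cong (proj₁ t *_) (⟦L*⟧ w q _)) ⟩
  Σl p (λ t → proj₁ t * Σl w (λ i → ⟦ q ⟧ ((d ⊖ toZ (proj₂ t)) ⊖ ê i)))
    ≡⟨ Σ-cong p (λ t → sym (Σ-* (proj₁ t) w _)) ⟩
  Σl p (λ t → Σl w (λ i → proj₁ t * ⟦ q ⟧ ((d ⊖ toZ (proj₂ t)) ⊖ ê i)))
    ≡⟨ Σ-swap p w _ ⟩
  Σl w (λ i → Σl p (λ t → proj₁ t * ⟦ q ⟧ ((d ⊖ toZ (proj₂ t)) ⊖ ê i)))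
    ≡⟨ Σ-cong w (λ i → Σ-cong p (λ t → cong (λ z → proj₁ t * ⟦ q ⟧ z) (⊖-comm d (toZ (proj₂ t)) (ê i)))) ⟩
  Σl w (λ i → Σl p (λ t → proj₁ t * ⟦ q ⟧ ((d ⊖ ê i) ⊖ toZ (proj₂ t))))
    ≡⟨ Σ-cong w (λ i → sym (⟦*P⟧ˡ p q (d ⊖ ê i))) ⟩
  Σl w (λ i → ⟦ p *P q ⟧ (d ⊖ ê i)) ∎
  where open ≡-Reasoning

flag : ∀ {n} (u : ℕ) → List (Fin n) → List ℕ → Poly n
flag u π ls = prodP (L.map (λ ℓ → linSum (take ℓ π) ^P u) ls)

totalPow : (n v : ℕ) → Poly n
totalPow n v = linSum (allFin n) ^P v

flagProd : (n u : ℕ) → List (Fin n) → Poly n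
flagProd n u π = flag u π (L.map suc (upTo (n ∸ 1)))

termQ : (n u v : ℕ) → List (Fin n) → Poly n
termQ n u v π = flagProd n u π *P totalPow n v

coeffQ : (n u v : ℕ) → Vec ℤ n → ℤ
coeffQ n u v d = Σl (Sym n) (λ π → sgn π * ⟦ termQ n u v π ⟧ d)

α≡coeffQ : ∀ n u v (d : Vec ℕ n) → α n u v d ≡ coeffQ n u v (toZ d)
α≡coeffQ n u v d = trans (coeff≡ d (Q n u v)) (trans (⟦sumP⟧ (L.map term (Sym n)) (toZ d)) (trans (Σ-map term (Sym n) (λ p → ⟦ p ⟧ (toZ d)))
  (Σ-cong (Sym n) (λ π → ⟦scale⟧ (sgn π) (termQ n u v π) (toZ d)))))
  where term : List (Fin n) → Poly n
        term π = scaleP (sgn π) (termQ n u v π)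

termQ-suc : ∀ n u v π (d : Vec ℤ n) → ⟦ termQ n u (suc v) π ⟧ d ≡ Σl (allFin n) (λ j → ⟦ termQ n u v π ⟧ (d ⊖ ê j))
termQ-suc n u v π = ⟦*L*⟧ (flagProd n u π) (allFin n) (totalPow n v)

coeffQ-suc : ∀ n u v (d : Vec ℤ n) → coeffQ n u (suc v) d ≡ Σl (allFin n) (λ j → coeffQ n u v (d ⊖ ê j))
coeffQ-suc n u v d = trans (Σ-cong (Sym n) (λ π → trans (cong (sgn π *_) (termQ-suc n u v π d)) (sym (Σ-* (sgn π) (allFin n) _))))
  (Σ-swap (Sym n) (allFin n) _)

lookup-unitV≡ : ∀ {n} (j : Fin n) → lookup (unitV j) j ≡ 1
lookup-unitV≡ j = VP.lookup∘updateAt j (replicate _ 0)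

lookup-unitV≢ : ∀ {n} (j i : Fin n) → i ≢ j → lookup (unitV j) i ≡ 0
lookup-unitV≢ j i ne = trans (VP.lookup∘updateAt′ i j ne (replicate _ 0)) (VP.lookup-replicate i 0)

lookup-toZ : ∀ {n} (v : Vec ℕ n) (i : Fin n) → lookup (toZ v) i ≡ + lookup v i
lookup-toZ v i = VP.lookup-map i _ v

τ : ∀ {m} → Fin m → Fin (suc m) → Fin (suc m)
τ {suc m} F.zero F.zero = F.suc F.zero
τ {suc m} F.zero (F.suc F.zero) = F.zero
τ {suc m} F.zero (F.suc (F.suc k)) = F.suc (F.suc k)
τ {suc m} (F.suc j) F.zero = F.zero
τ {suc m} (F.suc j) (F.suc k) = F.suc (τ j k)

τ-invol : ∀ {m} (j : Fin m) (k : Fin (suc m)) → τ j (τ j k) ≡ k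
τ-invol {suc m} F.zero F.zero = refl
τ-invol {suc m} F.zero (F.suc F.zero) = refl
τ-invol {suc m} F.zero (F.suc (F.suc k)) = refl
τ-invol {suc m} (F.suc j) F.zero = refl
τ-invol {suc m} (F.suc j) (F.suc k) = cong F.suc (τ-invol j k)

τ-a : ∀ {m} (j : Fin m) → τ j (F.inject₁ j) ≡ F.suc j
τ-a {suc m} F.zero = refl
τ-a {suc m} (F.suc j) = cong F.suc (τ-a j)

τ-b : ∀ {m} (j : Fin m) → τ j (F.suc j) ≡ F.inject₁ j
τ-b {suc m} F.zero = refl
τ-b {suc m} (F.suc j) = cong F.suc (τ-b j)

τ-other : ∀ {m} (j : Fin m) (k : Fin (suc m)) → k ≢ F.inject₁ j → k ≢ F.suc j → τ j k ≡ k
τ-other {suc m} F.zero F.zero h1 h2 = ⊥-elim (h1 refl)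
τ-other {suc m} F.zero (F.suc F.zero) h1 h2 = ⊥-elim (h2 refl)
τ-other {suc m} F.zero (F.suc (F.suc k)) h1 h2 = refl
τ-other {suc m} (F.suc j) F.zero h1 h2 = refl
τ-other {suc m} (F.suc j) (F.suc k) h1 h2 = cong F.suc (τ-other j k (λ e → h1 (cong F.suc e)) (λ e → h2 (cong F.suc e)))

tabulate-τ↭ : ∀ {A : Set} {m} (j : Fin m) (f : Fin (suc m) → A) → L.tabulate (f ∘ τ j) ↭ L.tabulate f
tabulate-τ↭ {m = suc m} F.zero f = swap (f (F.suc F.zero)) (f F.zero) Perm.refl
tabulate-τ↭ {m = suc m} (F.suc j) f = prep (f F.zero) (tabulate-τ↭ j (f ∘ F.suc))

allFin-τ↭ : ∀ {m} (j : Fin m) → L.map (τ j) (allFin (suc m)) ↭ allFin (suc m)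
allFin-τ↭ j = subst (_↭ allFin _) (sym (LP.map-tabulate id (τ j))) (tabulate-τ↭ j id)

Σ-congA : ∀ {A : Set} (xs : List A) {f g : A → ℤ} → All (λ x → f x ≡ g x) xs → Σl xs f ≡ Σl xs g
Σ-congA [] [] = refl
Σ-congA (x ∷ xs) (p ∷ ps) = cong₂ _+_ p (Σ-congA xs ps)

Σ-0A : ∀ {A : Set} (xs : List A) {f : A → ℤ} → All (λ x → f x ≡ 0ℤ) xs → Σl xs f ≡ 0ℤ
Σ-0A xs h = trans (Σ-congA xs h) (Σ-0 xs (λ _ → refl))

ins↭ : ∀ {A : Set} (x : A) (ys : List A) → All (λ σ → σ ↭ (x ∷ ys)) (insertions x ys)
ins↭ x [] = Perm.refl ∷ []
ins↭ x (y ∷ ys) = Perm.refl ∷ AP.map⁺ (All.map (λ p → Perm.trans (prep y p) (swap y x Perm.refl)) (ins↭ x ys))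

perms↭ : ∀ {A : Set} (l : List A) → All (λ π → π ↭ l) (perms l)
perms↭ [] = Perm.refl ∷ []
perms↭ (x ∷ xs) = AP.concat⁺ (AP.map⁺ (All.map (λ {ρ} p → All.map (λ q → Perm.trans q (prep x p)) (ins↭ x ρ)) (perms↭ xs)))

Σ-perms-cong : ∀ {A : Set} (l : List A) {f g : List A → ℤ} →
               (∀ π → π ↭ l → f π ≡ g π) → Σl (perms l) f ≡ Σl (perms l) g
Σ-perms-cong l h = Σ-congA (perms l) (All.map (λ {π} → h π) (perms↭ l))

Σ-perms-0 : ∀ {A : Set} (l : List A) {f : List A → ℤ} →
            (∀ π → π ↭ l → f π ≡ 0ℤ) → Σl (perms l) f ≡ 0ℤ
Σ-perms-0 l h = trans (Σ-perms-cong l h) (Σ-0 (perms l) (λ _ → refl))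

Σ-ins-map : ∀ {A B : Set} (g : A → B) (x : A) (ys : List A) (F : List B → ℤ) →
  Σl (insertions (g x) (L.map g ys)) F ≡ Σl (insertions x ys) (F ∘ L.map g)
Σ-ins-map g x [] F = refl
Σ-ins-map g x (y ∷ ys) F = cong (λ z → F (g x ∷ g y ∷ L.map g ys) + z)
  (trans (Σ-map (g y ∷_) (insertions (g x) (L.map g ys)) F)
  (trans (Σ-ins-map g x ys (F ∘ (g y ∷_))) (sym (Σ-map (y ∷_) (insertions x ys) (F ∘ L.map g)))))

Σ-perms-map : ∀ {A B : Set} (g : A → B) (l : List A) (F : List B → ℤ) →
  Σl (perms (L.map g l)) F ≡ Σl (perms l) (F ∘ L.map g)
Σ-perms-map g [] F = refl
Σ-perms-map g (x ∷ xs) F =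
  trans (Σ-concatMap (insertions (g x)) (perms (L.map g xs)) F)
  (trans (Σ-perms-map g xs (λ ρ → Σl (insertions (g x) ρ) F))
  (trans (Σ-cong (perms xs) (λ ρ → Σ-ins-map g x ρ F))
  (sym (Σ-concatMap (insertions x) (perms xs) (F ∘ L.map g)))))

insertTwice : ∀ {A : Set} → A → A → List A → (List A → ℤ) → ℤ
insertTwice x y ρ F = Σl (insertions y ρ) (λ σ → Σl (insertions x σ) F)

insertTwice-∷ : ∀ {A : Set} (x y z : A) (zs : List A) (F : List A → ℤ) →
  insertTwice x y (z ∷ zs) F ≡ F (x ∷ y ∷ z ∷ zs) + F (y ∷ x ∷ z ∷ zs) + Σl (insertions x zs) (λ w → F (y ∷ z ∷ w))
                     + Σl (insertions y zs) (λ w → F (x ∷ z ∷ w)) + insertTwice x y zs (F ∘ (z ∷_))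
insertTwice-∷ x y z zs F = trans (cong₂ _+_ (cong (λ q → F (x ∷ y ∷ z ∷ zs) + q) startY) startZ)
  (regroup (F (x ∷ y ∷ z ∷ zs)) (F (y ∷ x ∷ z ∷ zs)) (Σl (insertions x zs) (λ w → F (y ∷ z ∷ w)))
           (Σl (insertions y zs) (λ w → F (x ∷ z ∷ w))) (insertTwice x y zs (F ∘ (z ∷_))))
  where
  startY : Σl (L.map (y ∷_) (insertions x (z ∷ zs))) F ≡ F (y ∷ x ∷ z ∷ zs) + Σl (insertions x zs) (λ w → F (y ∷ z ∷ w))
  startY = trans (Σ-map (y ∷_) (insertions x (z ∷ zs)) F) (cong (λ q → F (y ∷ x ∷ z ∷ zs) + q) (Σ-map (z ∷_) (insertions x zs) (F ∘ (y ∷_))))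
  startZ : Σl (L.map (z ∷_) (insertions y zs)) (λ σ → Σl (insertions x σ) F)
       ≡ Σl (insertions y zs) (λ w → F (x ∷ z ∷ w)) + insertTwice x y zs (F ∘ (z ∷_))
  startZ = trans (Σ-map (z ∷_) (insertions y zs) _)
       (trans (Σ-cong (insertions y zs) (λ σ → cong (λ q → F (x ∷ z ∷ σ) + q) (Σ-map (z ∷_) (insertions x σ) F)))
       (Σ-+ (insertions y zs) _ _))
  regroup : ∀ a b c d e → (a + (b + c)) + (d + e) ≡ a + b + c + d + e
  regroup = solve-∀

insertTwice-comm : ∀ {A : Set} (x y : A) (ρ : List A) (F : List A → ℤ) → insertTwice x y ρ F ≡ insertTwice y x ρ F
insertTwice-comm x y [] F = swap₂ (F (x ∷ y ∷ [])) (F (y ∷ x ∷ []))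
  where swap₂ : ∀ a b → (a + (b + 0ℤ)) + 0ℤ ≡ (b + (a + 0ℤ)) + 0ℤ
        swap₂ = solve-∀
insertTwice-comm x y (z ∷ zs) F = begin
  insertTwice x y (z ∷ zs) F                 ≡⟨ insertTwice-∷ x y z zs F ⟩
  pxy + pyx + pyz + pxz + insertTwice x y zs G ≡⟨ cong (λ q → pxy + pyx + pyz + pxz + q) (insertTwice-comm x y zs G) ⟩
  pxy + pyx + pyz + pxz + insertTwice y x zs G ≡⟨ swap₄ pxy pyx pyz pxz (insertTwice y x zs G) ⟩
  pyx + pxy + pxz + pyz + insertTwice y x zs G ≡⟨ sym (insertTwice-∷ y x z zs F) ⟩
  insertTwice y x (z ∷ zs) F                 ∎
  where
  open ≡-Reasoning
  G = F ∘ (z ∷_)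
  pxy = F (x ∷ y ∷ z ∷ zs)
  pyx = F (y ∷ x ∷ z ∷ zs)
  pyz = Σl (insertions x zs) (λ w → F (y ∷ z ∷ w))
  pxz = Σl (insertions y zs) (λ w → F (x ∷ z ∷ w))
  swap₄ : ∀ a b c d e → a + b + c + d + e ≡ b + a + d + c + e
  swap₄ = solve-∀

Σ-perms-↭ : ∀ {A : Set} {l l' : List A} → l ↭ l' → ∀ F → Σl (perms l) F ≡ Σl (perms l') F
Σ-perms-↭ Perm.refl F = refl
Σ-perms-↭ {l = x ∷ l} {x ∷ l'} (prep x p) F =
  trans (Σ-concatMap (insertions x) (perms l) F)
  (trans (Σ-perms-↭ p (λ ρ → Σl (insertions x ρ) F)) (sym (Σ-concatMap (insertions x) (perms l') F)))
Σ-perms-↭ {l = x ∷ y ∷ l} {y ∷ x ∷ l'} (swap x y p) F =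
  trans (Σ-concatMap (insertions x) (concatMap (insertions y) (perms l)) F)
  (trans (Σ-concatMap (insertions y) (perms l) _)
  (trans (Σ-perms-↭ p (λ ρ → insertTwice x y ρ F))
  (trans (Σ-cong (perms l') (λ ρ → insertTwice-comm x y ρ F))
  (sym (trans (Σ-concatMap (insertions y) (concatMap (insertions x) (perms l')) F)
          (Σ-concatMap (insertions x) (perms l') _))))))
Σ-perms-↭ (Perm.trans p q) F = trans (Σ-perms-↭ p F) (Σ-perms-↭ q F)

-- We
-- show that renaming the letters a = j, b = j+1 of a word in which each occurs
-- once changes inv by exactly ±1, hence flips the sign.  The bookkeeping
-- identity is inv (τ π) + #(b before a) = inv π + #(a before b).

𝟙 : ∀ {P : Set} → Dec P → ℕ
𝟙 (yes _) = 1
𝟙 (no _) = 0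

𝟙≡1 : ∀ {P : Set} (d : Dec P) → P → 𝟙 d ≡ 1
𝟙≡1 (yes _) p = refl
𝟙≡1 (no np) p = ⊥-elim (np p)

𝟙≡0 : ∀ {P : Set} (d : Dec P) → ¬ P → 𝟙 d ≡ 0
𝟙≡0 (yes p) np = ⊥-elim (np p)
𝟙≡0 (no _) np = refl

𝟙-resp : ∀ {P Q : Set} (d : Dec P) (e : Dec Q) → (P → Q) → (Q → P) → 𝟙 d ≡ 𝟙 e
𝟙-resp (yes p) (yes q) f g = refl
𝟙-resp (yes p) (no q) f g = ⊥-elim (q (f p))
𝟙-resp (no p) (yes q) f g = ⊥-elim (p (g q))
𝟙-resp (no p) (no q) f g = refl

occ : ∀ {n} → Fin n → List (Fin n) → ℕ
occ c [] = 0
occ c (x ∷ xs) = 𝟙 (x F.≟ c) ℕ.+ occ c xs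

occ-↭ : ∀ {n} (c : Fin n) {xs ys : List (Fin n)} → xs ↭ ys → occ c xs ≡ occ c ys
occ-↭ c Perm.refl = refl
occ-↭ c (prep x p) = cong (𝟙 (x F.≟ c) ℕ.+_) (occ-↭ c p)
occ-↭ c {_ ∷ _ ∷ _} {_ ∷ _ ∷ ys} (swap x y p) = trans (cong (λ z → 𝟙 (x F.≟ c) ℕ.+ (𝟙 (y F.≟ c) ℕ.+ z)) (occ-↭ c p))
  (rearrange (𝟙 (x F.≟ c)) (𝟙 (y F.≟ c)) (occ c ys))
  where rearrange : ∀ p q r → p ℕ.+ (q ℕ.+ r) ≡ q ℕ.+ (p ℕ.+ r)
        rearrange p q r = trans (sym (NP.+-assoc p q r)) (trans (cong (ℕ._+ r) (NP.+-comm p q)) (NP.+-assoc q p r))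
occ-↭ c (Perm.trans p q) = trans (occ-↭ c p) (occ-↭ c q)

occ-map-suc : ∀ {n} (c : Fin n) (xs : List (Fin n)) → occ (F.suc c) (L.map F.suc xs) ≡ occ c xs
occ-map-suc c [] = refl
occ-map-suc c (x ∷ xs) = cong₂ ℕ._+_ (𝟙-resp _ _ FP.suc-injective (cong F.suc)) (occ-map-suc c xs)

occ-map-suc-zero : ∀ {n} (xs : List (Fin n)) → occ F.zero (L.map F.suc xs) ≡ 0
occ-map-suc-zero [] = refl
occ-map-suc-zero (x ∷ xs) = occ-map-suc-zero xs

occ-allFin : ∀ {n} (c : Fin n) → occ c (allFin n) ≡ 1
occ-allFin {suc n} F.zero = cong suc (trans (cong (occ {suc n} F.zero) (sym (LP.map-tabulate {n = n} id F.suc))) (occ-map-suc-zero (allFin n)))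
occ-allFin {suc n} (F.suc c) = trans (cong (occ (F.suc c)) (sym (LP.map-tabulate {n = n} id F.suc))) (trans (occ-map-suc c (allFin n)) (occ-allFin c))

smaller-∷ : ∀ {n} (x y : Fin n) (ys : List (Fin n)) →
  length (L.filter (λ z → z F.<? x) (y ∷ ys)) ≡ 𝟙 (y F.<? x) ℕ.+ length (L.filter (λ z → z F.<? x) ys)
smaller-∷ x y ys with y F.<? x
... | yes p = cong length (LP.filter-accept (λ z → z F.<? x) p)
... | no p = cong length (LP.filter-reject (λ z → z F.<? x) p)

pairs : ∀ {n} → Fin n → Fin n → List (Fin n) → ℕ
pairs x y [] = 0
pairs x y (z ∷ zs) = 𝟙 (z F.≟ x) ℕ.* occ y zs ℕ.+ pairs x y zs

notBoth : ∀ {n} {a b : Fin n} → a ≢ b → ∀ x → 𝟙 (x F.≟ a) ℕ.* 𝟙 (x F.≟ b) ≡ 0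
notBoth {a = a} {b} a≢b x with x F.≟ a
... | no _ = refl
... | yes refl = trans (NP.+-identityʳ _) (𝟙≡0 (x F.≟ b) a≢b)

crossPairs : ∀ {n} {a b : Fin n} → a ≢ b → ∀ π → pairs a b π ℕ.+ pairs b a π ≡ occ a π ℕ.* occ b π
crossPairs a≢b [] = refl
crossPairs {a = a} {b} a≢b (x ∷ xs) = begin
    (IA ℕ.* occ b xs ℕ.+ pairs a b xs) ℕ.+ (IB ℕ.* occ a xs ℕ.+ pairs b a xs)
      ≡⟨ rearrange IA IB (occ a xs) (occ b xs) (pairs a b xs) (pairs b a xs) ⟩
    IA ℕ.* occ b xs ℕ.+ occ a xs ℕ.* IB ℕ.+ (pairs a b xs ℕ.+ pairs b a xs)
      ≡⟨ cong (λ z → IA ℕ.* occ b xs ℕ.+ occ a xs ℕ.* IB ℕ.+ z) (crossPairs a≢b xs) ⟩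
    IA ℕ.* occ b xs ℕ.+ occ a xs ℕ.* IB ℕ.+ occ a xs ℕ.* occ b xs
      ≡⟨ cong (λ z → z ℕ.+ IA ℕ.* occ b xs ℕ.+ occ a xs ℕ.* IB ℕ.+ occ a xs ℕ.* occ b xs) (sym (notBoth a≢b x)) ⟩
    IA ℕ.* IB ℕ.+ IA ℕ.* occ b xs ℕ.+ occ a xs ℕ.* IB ℕ.+ occ a xs ℕ.* occ b xs
      ≡⟨ expand IA IB (occ a xs) (occ b xs) ⟩
    (IA ℕ.+ occ a xs) ℕ.* (IB ℕ.+ occ b xs) ∎
  where
  open ≡-Reasoning
  IA = 𝟙 (x F.≟ a)
  IB = 𝟙 (x F.≟ b)
  rearrange : ∀ A B ca cb n1 n2 → (A ℕ.* cb ℕ.+ n1) ℕ.+ (B ℕ.* ca ℕ.+ n2) ≡ A ℕ.* cb ℕ.+ ca ℕ.* B ℕ.+ (n1 ℕ.+ n2)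
  rearrange = NS.solve-∀
  expand : ∀ A B ca cb → A ℕ.* B ℕ.+ A ℕ.* cb ℕ.+ ca ℕ.* B ℕ.+ ca ℕ.* cb ≡ (A ℕ.+ ca) ℕ.* (B ℕ.+ cb)
  expand = NS.solve-∀

sign-flip : ∀ i k p q → p ℕ.+ q ≡ 1 → i ℕ.+ q ≡ k ℕ.+ p → -1ℤ ℤ.^ i ≡ - (-1ℤ ℤ.^ k)
sign-flip i k zero (suc zero) _ e = begin
  -1ℤ ℤ.^ i             ≡⟨ sym (ZP.neg-involutive _) ⟩
  - (- (-1ℤ ℤ.^ i))     ≡⟨ cong -_ (sym (ZP.-1*i≡-i _)) ⟩
  - (-1ℤ ℤ.^ suc i)     ≡⟨ cong (λ l → - (-1ℤ ℤ.^ l)) (trans (NP.+-comm 1 i) (trans e (NP.+-identityʳ k))) ⟩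
  - (-1ℤ ℤ.^ k)         ∎
  where open ≡-Reasoning
sign-flip i k (suc zero) zero _ e =
  trans (cong (-1ℤ ℤ.^_) (trans (sym (NP.+-identityʳ i)) (trans e (NP.+-comm k 1)))) (ZP.-1*i≡-i _)

module Sign {m : ℕ} (j : Fin m) where
  a b : Fin (suc m)
  a = F.inject₁ j
  b = F.suc j

  toℕ-a : toℕ a ≡ toℕ j
  toℕ-a = FP.toℕ-inject₁ j

  a≢b : a ≢ b
  a≢b e = NP.<-irrefl (trans (sym toℕ-a) (cong toℕ e)) (NP.n<1+n (toℕ j))

  data Position (k : Fin (suc m)) : Set where
    at-a : k ≡ a → Position k
    at-b : k ≡ b → Position k
    elsewhere : k ≢ a → k ≢ b → Position k

  position : ∀ k → Position k
  position k with k F.≟ a | k F.≟ b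
  ... | yes p | _ = at-a p
  ... | no p | yes q = at-b q
  ... | no p | no q = elsewhere p q

  below-b⇔below-a : ∀ o → o ≢ a → (o F.< b → o F.< a) × (o F.< a → o F.< b)
  below-b⇔below-a o ne = (λ h → subst (toℕ o ℕ.<_) (sym toℕ-a) (NP.≤∧≢⇒< (NP.≤-pred h) (λ e → ne (FP.toℕ-injective (trans e (sym toℕ-a))))))
             , (λ h → NP.m≤n⇒m≤1+n (subst (toℕ o ℕ.<_) toℕ-a h))

  above-b⇔above-a : ∀ o → o ≢ b → (b F.< o → a F.< o) × (a F.< o → b F.< o)
  above-b⇔above-a o ne = (λ h → subst (ℕ._< toℕ o) (sym toℕ-a) (NP.<⇒≤ h))
             , (λ h → NP.≤∧≢⇒< (subst (ℕ._< toℕ o) toℕ-a h) (λ e → ne (FP.toℕ-injective (sym e))))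

  𝟙<-irrefl : ∀ (k : Fin (suc m)) → 𝟙 (k F.<? k) ≡ 0
  𝟙<-irrefl k = 𝟙≡0 (k F.<? k) (NP.<-irrefl refl)

  [a<b]≡1 : 𝟙 (a F.<? b) ≡ 1
  [a<b]≡1 = 𝟙≡1 (a F.<? b) (NP.≤-reflexive (cong suc toℕ-a))
  [b<a]≡0 : 𝟙 (b F.<? a) ≡ 0
  [b<a]≡0 = 𝟙≡0 (b F.<? a) (λ h → NP.<-asym h (NP.≤-reflexive (cong suc toℕ-a)))
  [a≟a]≡1 : 𝟙 (a F.≟ a) ≡ 1
  [a≟a]≡1 = 𝟙≡1 (a F.≟ a) refl
  [b≟b]≡1 : 𝟙 (b F.≟ b) ≡ 1
  [b≟b]≡1 = 𝟙≡1 (b F.≟ b) refl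
  [a≟b]≡0 : 𝟙 (a F.≟ b) ≡ 0
  [a≟b]≡0 = 𝟙≡0 (a F.≟ b) a≢b
  [b≟a]≡0 : 𝟙 (b F.≟ a) ≡ 0
  [b≟a]≡0 = 𝟙≡0 (b F.≟ a) (λ e → a≢b (sym e))

  inversion-τ : ∀ x y → 𝟙 (τ j y F.<? τ j x) ℕ.+ 𝟙 (x F.≟ b) ℕ.* 𝟙 (y F.≟ a) ≡ 𝟙 (y F.<? x) ℕ.+ 𝟙 (x F.≟ a) ℕ.* 𝟙 (y F.≟ b)
  inversion-τ x y with position x | position y
  ... | at-a refl | at-a refl rewrite τ-a j | 𝟙<-irrefl a | 𝟙<-irrefl b | [a≟a]≡1 | [a≟b]≡0 = refl
  ... | at-a refl | at-b refl rewrite τ-a j | τ-b j | [a<b]≡1 | [b<a]≡0 | [a≟a]≡1 | [a≟b]≡0 | [b≟b]≡1 = refl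
  ... | at-b refl | at-a refl rewrite τ-a j | τ-b j | [a<b]≡1 | [b<a]≡0 | [a≟a]≡1 | [a≟b]≡0 | [b≟a]≡0 | [b≟b]≡1 = refl
  ... | at-b refl | at-b refl rewrite τ-b j | 𝟙<-irrefl a | 𝟙<-irrefl b | [b≟b]≡1 | [b≟a]≡0 = refl
  ... | at-a refl | elsewhere p q rewrite τ-a j | τ-other j y p q | [a≟a]≡1 | [a≟b]≡0 | 𝟙≡0 (y F.≟ b) q =
    cong (ℕ._+ 0) (𝟙-resp _ _ (proj₁ (below-b⇔below-a y p)) (proj₂ (below-b⇔below-a y p)))
  ... | at-b refl | elsewhere p q rewrite τ-b j | τ-other j y p q | [b≟b]≡1 | [b≟a]≡0 | 𝟙≡0 (y F.≟ a) p =
    cong (ℕ._+ 0) (𝟙-resp _ _ (proj₂ (below-b⇔below-a y p)) (proj₁ (below-b⇔below-a y p)))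
  ... | elsewhere p q | at-a refl rewrite τ-a j | τ-other j x p q | [a≟a]≡1 | [a≟b]≡0 | 𝟙≡0 (x F.≟ a) p | 𝟙≡0 (x F.≟ b) q =
    cong (ℕ._+ 0) (𝟙-resp _ _ (proj₁ (above-b⇔above-a x q)) (proj₂ (above-b⇔above-a x q)))
  ... | elsewhere p q | at-b refl rewrite τ-b j | τ-other j x p q | [b≟b]≡1 | [b≟a]≡0 | 𝟙≡0 (x F.≟ a) p | 𝟙≡0 (x F.≟ b) q =
    cong (ℕ._+ 0) (𝟙-resp _ _ (proj₂ (above-b⇔above-a x q)) (proj₁ (above-b⇔above-a x q)))
  ... | elsewhere p q | elsewhere p' q' rewrite τ-other j x p q | τ-other j y p' q' | 𝟙≡0 (x F.≟ a) p | 𝟙≡0 (x F.≟ b) q = refl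

  smaller : Fin (suc m) → List (Fin (suc m)) → ℕ
  smaller x xs = length (L.filter (λ z → z F.<? x) xs)

  inversionsOf-τ : ∀ x xs → smaller (τ j x) (L.map (τ j) xs) ℕ.+ 𝟙 (x F.≟ b) ℕ.* occ a xs ≡ smaller x xs ℕ.+ 𝟙 (x F.≟ a) ℕ.* occ b xs
  inversionsOf-τ x [] = trans (NP.*-zeroʳ (𝟙 (x F.≟ b))) (sym (NP.*-zeroʳ (𝟙 (x F.≟ a))))
  inversionsOf-τ x (y ∷ ys) = begin
      smaller (τ j x) (τ j y ∷ L.map (τ j) ys) ℕ.+ IB ℕ.* (𝟙 (y F.≟ a) ℕ.+ occ a ys)
        ≡⟨ cong (λ z → z ℕ.+ IB ℕ.* (𝟙 (y F.≟ a) ℕ.+ occ a ys)) (smaller-∷ (τ j x) (τ j y) (L.map (τ j) ys)) ⟩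
      (𝟙 (τ j y F.<? τ j x) ℕ.+ smaller (τ j x) (L.map (τ j) ys)) ℕ.+ IB ℕ.* (𝟙 (y F.≟ a) ℕ.+ occ a ys)
        ≡⟨ rearrange (𝟙 (τ j y F.<? τ j x)) (smaller (τ j x) (L.map (τ j) ys)) IB (𝟙 (y F.≟ a)) (occ a ys) ⟩
      (𝟙 (τ j y F.<? τ j x) ℕ.+ IB ℕ.* 𝟙 (y F.≟ a)) ℕ.+ (smaller (τ j x) (L.map (τ j) ys) ℕ.+ IB ℕ.* occ a ys)
        ≡⟨ cong₂ ℕ._+_ (inversion-τ x y) (inversionsOf-τ x ys) ⟩
      (𝟙 (y F.<? x) ℕ.+ IA ℕ.* 𝟙 (y F.≟ b)) ℕ.+ (smaller x ys ℕ.+ IA ℕ.* occ b ys)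
        ≡⟨ sym (rearrange (𝟙 (y F.<? x)) (smaller x ys) IA (𝟙 (y F.≟ b)) (occ b ys)) ⟩
      (𝟙 (y F.<? x) ℕ.+ smaller x ys) ℕ.+ IA ℕ.* (𝟙 (y F.≟ b) ℕ.+ occ b ys)
        ≡⟨ cong (λ z → z ℕ.+ IA ℕ.* (𝟙 (y F.≟ b) ℕ.+ occ b ys)) (sym (smaller-∷ x y ys)) ⟩
      smaller x (y ∷ ys) ℕ.+ IA ℕ.* (𝟙 (y F.≟ b) ℕ.+ occ b ys) ∎
    where
    open ≡-Reasoning
    IA = 𝟙 (x F.≟ a)
    IB = 𝟙 (x F.≟ b)
    rearrange : ∀ p f q u c → (p ℕ.+ f) ℕ.+ q ℕ.* (u ℕ.+ c) ≡ (p ℕ.+ q ℕ.* u) ℕ.+ (f ℕ.+ q ℕ.* c)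
    rearrange = NS.solve-∀

  inversions-τ : ∀ π → inversions (L.map (τ j) π) ℕ.+ pairs b a π ≡ inversions π ℕ.+ pairs a b π
  inversions-τ [] = refl
  inversions-τ (x ∷ xs) = trans (rearrange (smaller (τ j x) (L.map (τ j) xs)) (inversions (L.map (τ j) xs)) (𝟙 (x F.≟ b) ℕ.* occ a xs) (pairs b a xs))
    (trans (cong₂ ℕ._+_ (inversionsOf-τ x xs) (inversions-τ xs)) (sym (rearrange (smaller x xs) (inversions xs) (𝟙 (x F.≟ a) ℕ.* occ b xs) (pairs a b xs))))
    where rearrange : ∀ f i c n → (f ℕ.+ i) ℕ.+ (c ℕ.+ n) ≡ (f ℕ.+ c) ℕ.+ (i ℕ.+ n)
          rearrange = NS.solve-∀

  sgn-τ : ∀ π → occ a π ≡ 1 → occ b π ≡ 1 → sgn (L.map (τ j) π) ≡ - sgn π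
  sgn-τ π ca cb = sign-flip (inversions (L.map (τ j) π)) (inversions π) (pairs a b π) (pairs b a π)
    (trans (crossPairs a≢b π) (cong₂ ℕ._*_ ca cb)) (inversions-τ π)

linpow-↭ : ∀ {n} {w w' : List (Fin n)} → w ↭ w' → ∀ k → (linSum w ^P k) ≈ (linSum w' ^P k)
linpow-↭ p zero d = refl
linpow-↭ {w = w} {w'} p (suc k) d = trans (⟦L*⟧ w _ d) (trans (Σ-cong w (λ i → linpow-↭ p k (d ⊖ ê i)))
  (trans (Σ-↭ _ p) (sym (⟦L*⟧ w' _ d))))

module ExponentMap {k k' : ℕ} (φ : Vec ℕ k → Vec ℕ k') (σ : Fin k → Fin k')
  (φ-+ : ∀ e f → φ (zipWith ℕ._+_ e f) ≡ zipWith ℕ._+_ (φ e) (φ f))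
  (φ-0 : φ (replicate k 0) ≡ replicate k' 0)
  (φ-unit : ∀ i → φ (unitV i) ≡ unitV (σ i)) where

  mapTerm : ℤ × Vec ℕ k → ℤ × Vec ℕ k'
  mapTerm t = (proj₁ t , φ (proj₂ t))

  mapP : Poly k → Poly k'
  mapP = L.map mapTerm

  mapP-*P : ∀ p q → mapP (p *P q) ≡ mapP p *P mapP q
  mapP-*P [] q = refl
  mapP-*P ((a , e) ∷ p) q = trans (LP.map-++ mapTerm (L.map g q) (p *P q)) (cong₂ _++_ shifted (mapP-*P p q))
    where
    g : ℤ × Vec ℕ k → ℤ × Vec ℕ k
    g s = (a * proj₁ s , zipWith ℕ._+_ e (proj₂ s))
    g' : ℤ × Vec ℕ k' → ℤ × Vec ℕ k'
    g' s = (a * proj₁ s , zipWith ℕ._+_ (φ e) (proj₂ s))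
    shifted : mapP (L.map g q) ≡ L.map g' (mapP q)
    shifted = trans (sym (LP.map-∘ q)) (trans (LP.map-cong (λ s → cong (a * proj₁ s ,_) (φ-+ e (proj₂ s))) q) (LP.map-∘ q))

  mapP-1P : mapP 1P ≡ 1P
  mapP-1P = cong (λ z → (1ℤ , z) ∷ []) φ-0

  mapP-^ : ∀ p i → mapP (p ^P i) ≡ mapP p ^P i
  mapP-^ p zero = mapP-1P
  mapP-^ p (suc i) = trans (mapP-*P p (p ^P i)) (cong (mapP p *P_) (mapP-^ p i))

  mapP-prod : ∀ ps → mapP (prodP ps) ≡ prodP (L.map mapP ps)
  mapP-prod [] = mapP-1P
  mapP-prod (p ∷ ps) = trans (mapP-*P p (prodP ps)) (cong (mapP p *P_) (mapP-prod ps))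

  mapP-lin : ∀ w → mapP (linSum w) ≡ linSum (L.map σ w)
  mapP-lin w = trans (cong mapP (linSum≡ w)) (trans (sym (LP.map-∘ w))
    (trans (LP.map-cong (λ i → cong (1ℤ ,_) (φ-unit i)) w) (trans (LP.map-∘ w) (sym (linSum≡ (L.map σ w))))))

  mapP-flag : ∀ u π ls → mapP (flag u π ls) ≡ flag u (L.map σ π) ls
  mapP-flag u π ls = trans (mapP-prod (L.map pow ls)) (cong prodP (trans (sym (LP.map-∘ ls)) (LP.map-cong renamed ls)))
    where
    pow : ℕ → Poly k
    pow ℓ = linSum (take ℓ π) ^P u
    renamed : ∀ ℓ → mapP (pow ℓ) ≡ linSum (take ℓ (L.map σ π)) ^P u
    renamed ℓ = trans (mapP-^ (linSum (take ℓ π)) u) (cong (_^P u) (trans (mapP-lin (take ℓ π)) (cong linSum (sym (LP.take-map ℓ π)))))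

vext : ∀ {A : Set} {n} {v w : Vec A n} → (∀ i → lookup v i ≡ lookup w i) → v ≡ w
vext {v = v} {w} h = trans (sym (VP.tabulate∘lookup v)) (trans (VP.tabulate-cong h) (VP.tabulate∘lookup w))

module Ren {m : ℕ} (j : Fin m) where
  open Sign j

  perm : ∀ {A : Set} → Vec A (suc m) → Vec A (suc m)
  perm v = V.tabulate (λ k → lookup v (τ j k))

  lookup-perm : ∀ {A : Set} (v : Vec A (suc m)) k → lookup (perm v) k ≡ lookup v (τ j k)
  lookup-perm v k = VP.lookup∘tabulate (λ k → lookup v (τ j k)) k

  perm-invol : ∀ {A : Set} (v : Vec A (suc m)) → perm (perm v) ≡ v
  perm-invol v = vext (λ k → trans (lookup-perm (perm v) k) (trans (lookup-perm v (τ j k)) (cong (lookup v) (τ-invol j k))))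

  perm-zip : ∀ {A B C : Set} (f : A → B → C) e e' → perm (zipWith f e e') ≡ zipWith f (perm e) (perm e')
  perm-zip f e e' = vext (λ k → trans (lookup-perm (zipWith f e e') k) (trans (VP.lookup-zipWith f (τ j k) e e')
    (sym (trans (VP.lookup-zipWith f k (perm e) (perm e')) (cong₂ f (lookup-perm e k) (lookup-perm e' k))))))

  perm-rep : ∀ {A : Set} (x : A) → perm (replicate (suc m) x) ≡ replicate (suc m) x
  perm-rep x = vext (λ k → trans (lookup-perm (replicate (suc m) x) k) (trans (VP.lookup-replicate (τ j k) x) (sym (VP.lookup-replicate k x))))

  perm-map : ∀ {A B : Set} (f : A → B) v → perm (V.map f v) ≡ V.map f (perm v)
  perm-map f v = vext (λ k → trans (lookup-perm (V.map f v) k) (trans (VP.lookup-map (τ j k) f v) (sym (trans (VP.lookup-map k f (perm v)) (cong f (lookup-perm v k))))))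

  perm-unit : ∀ i → perm (unitV i) ≡ unitV (τ j i)
  perm-unit i = vext λ k → trans (lookup-perm (unitV i) k) (h k)
    where
    h : ∀ k → lookup (unitV i) (τ j k) ≡ lookup (unitV (τ j i)) k
    h k with k F.≟ τ j i
    ... | yes e = trans (cong (lookup (unitV i)) (trans (cong (τ j) e) (τ-invol j i)))
                  (trans (lookup-unitV≡ i) (sym (trans (cong (lookup (unitV (τ j i))) e) (lookup-unitV≡ (τ j i)))))
    ... | no ne = trans (lookup-unitV≢ i (τ j k) (λ e → ne (trans (sym (τ-invol j k)) (cong (τ j) e))))
                  (sym (lookup-unitV≢ (τ j i) k ne))

  open ExponentMap perm (τ j) (perm-zip ℕ._+_) (perm-rep 0) perm-unit public
    renaming (mapP to ren; mapTerm to permTerm; mapP-*P to ren-*P; mapP-^ to ren-^; mapP-lin to ren-lin)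

  ⟦ren⟧ : ∀ p d → ⟦ ren p ⟧ d ≡ ⟦ p ⟧ (perm d)
  ⟦ren⟧ p d = trans (Σ-map permTerm p (termAt d)) (Σ-cong p (λ t → cong (proj₁ t *_) (δ-resp _ _ _ _
    (λ h → trans (sym (perm-invol (toZ (proj₂ t)))) (cong perm (trans (perm-map _ (proj₂ t)) h)))
    (λ h → trans (sym (perm-map _ (proj₂ t))) (trans (cong perm h) (perm-invol d))))))

  ren-totalPow : ∀ v → ren (totalPow (suc m) v) ≈ totalPow (suc m) v
  ren-totalPow v d = trans (cong (λ p → ⟦ p ⟧ d) (trans (ren-^ _ v) (cong (_^P v) (ren-lin (allFin (suc m))))))
                           (linpow-↭ (allFin-τ↭ j) v d)

  termQ-τ : ∀ u v π d → ⟦ termQ (suc m) u v (L.map (τ j) π) ⟧ d ≡ ⟦ termQ (suc m) u v π ⟧ (perm d)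
  termQ-τ u v π d = begin
    ⟦ flagProd (suc m) u (L.map (τ j) π) *P T ⟧ d ≡⟨ cong (λ z → ⟦ z *P T ⟧ d) (sym (mapP-flag u π (L.map suc (upTo (suc m ∸ 1))))) ⟩
    ⟦ ren X *P T ⟧ d                              ≡⟨ *-congʳ (ren X) (λ x → sym (ren-totalPow v x)) d ⟩
    ⟦ ren X *P ren T ⟧ d                          ≡⟨ cong (λ z → ⟦ z ⟧ d) (sym (ren-*P X T)) ⟩
    ⟦ ren (X *P T) ⟧ d                            ≡⟨ ⟦ren⟧ (X *P T) d ⟩
    ⟦ X *P T ⟧ (perm d)                           ∎
    where
    open ≡-Reasoning
    X = flagProd (suc m) u π
    T = totalPow (suc m) v

  perm-fix : ∀ (d : Vec ℤ (suc m)) → lookup d a ≡ lookup d b → perm d ≡ d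
  perm-fix d e = vext (λ k → trans (lookup-perm d k) (h k (position k)))
    where
    h : ∀ k → Position k → lookup d (τ j k) ≡ lookup d k
    h k (at-a refl) = trans (cong (lookup d) (τ-a j)) (sym e)
    h k (at-b refl) = trans (cong (lookup d) (τ-b j)) e
    h k (elsewhere p q) = cong (lookup d) (τ-other j k p q)

self-negating : ∀ x → x ≡ - x → x ≡ 0ℤ
self-negating (+ zero) e = refl
self-negating (+ suc n) ()
self-negating (ℤ.negsuc n) ()

-- Antisymmetry: transposing two adjacent coordinates of d negates coeffQ, since
-- π ↦ τ ∘ π is a bijection of S_n that flips signs.
coeffQ-antisym : ∀ m u v (j : Fin m) (d : Vec ℤ (suc m)) → coeffQ (suc m) u v d ≡ - coeffQ (suc m) u v (Ren.perm j d)
coeffQ-antisym m u v j d = begin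
  Σl (perms (allFin (suc m))) f              ≡⟨ Σ-perms-↭ (↭-sym (allFin-τ↭ j)) f ⟩
  Σl (perms (L.map (τ j) (allFin (suc m)))) f ≡⟨ Σ-perms-map (τ j) (allFin (suc m)) f ⟩
  Σl (Sym (suc m)) (f ∘ L.map (τ j))         ≡⟨ Σ-perms-cong (allFin (suc m)) flip ⟩
  Σl (Sym (suc m)) (λ π → - g π)             ≡⟨ Σ-neg (Sym (suc m)) g ⟩
  - Σl (Sym (suc m)) g                       ∎
  where
  open ≡-Reasoning
  open Ren j
  open Sign j
  f g : List (Fin (suc m)) → ℤ
  f π = sgn π * ⟦ termQ (suc m) u v π ⟧ d
  g π = sgn π * ⟦ termQ (suc m) u v π ⟧ (perm d)
  flip : ∀ π → π ↭ allFin (suc m) → f (L.map (τ j) π) ≡ - g π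
  flip π p = trans (cong₂ _*_ (sgn-τ π (trans (occ-↭ a p) (occ-allFin a)) (trans (occ-↭ b p) (occ-allFin b)))
                              (termQ-τ u v π d))
                   (sym (ZP.neg-distribˡ-* (sgn π) _))

coeffQ-vanishes : ∀ m u v (d : Vec ℤ (suc m)) (j : Fin m) → lookup d (F.inject₁ j) ≡ lookup d (F.suc j) → coeffQ (suc m) u v d ≡ 0ℤ
coeffQ-vanishes m u v d j e =
  self-negating _ (trans (coeffQ-antisym m u v j d) (cong (λ x → - coeffQ (suc m) u v x) (Ren.perm-fix j d e)))

allFin-∷ʳ : ∀ k → allFin (suc k) ≡ L.map F.inject₁ (allFin k) ∷ʳ F.fromℕ k
allFin-∷ʳ zero = refl
allFin-∷ʳ (suc k) = cong (F.zero ∷_) (begin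
    L.tabulate F.suc                                  ≡⟨ sym (LP.map-tabulate id F.suc) ⟩
    L.map F.suc (allFin (suc k))                      ≡⟨ cong (L.map F.suc) (allFin-∷ʳ k) ⟩
    L.map F.suc (L.map F.inject₁ (allFin k) ∷ʳ F.fromℕ k) ≡⟨ LP.map-++ F.suc (L.map F.inject₁ (allFin k)) _ ⟩
    L.map F.suc (L.map F.inject₁ (allFin k)) ∷ʳ F.suc (F.fromℕ k) ≡⟨ cong (_∷ʳ F.suc (F.fromℕ k)) (trans (sym (LP.map-∘ (allFin k))) (LP.map-tabulate id (F.suc ∘ F.inject₁))) ⟩
    L.tabulate (F.suc ∘ F.inject₁) ∷ʳ F.suc (F.fromℕ k) ≡⟨ cong (_∷ʳ F.suc (F.fromℕ k)) (sym (LP.map-tabulate F.suc F.inject₁)) ⟩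
    L.map F.inject₁ (L.tabulate F.suc) ∷ʳ F.suc (F.fromℕ k) ∎)
  where open ≡-Reasoning

Σ-insertions-∷ʳ : ∀ {A : Set} (x z : A) (zs : List A) (f : List A → ℤ) →
  Σl (insertions x (zs ∷ʳ z)) f ≡ f ((zs ∷ʳ z) ∷ʳ x) + Σl (insertions x zs) (λ w → f (w ∷ʳ z))
Σ-insertions-∷ʳ x z [] f = rearrange (f (x ∷ z ∷ [])) (f (z ∷ x ∷ []))
  where rearrange : ∀ p q → p + (q + 0ℤ) ≡ q + (p + 0ℤ)
        rearrange = solve-∀
Σ-insertions-∷ʳ x z (a ∷ as) f =
  trans (cong (λ q → f (x ∷ a ∷ (as ∷ʳ z)) + q) (trans (Σ-map (a ∷_) (insertions x (as ∷ʳ z)) f) (Σ-insertions-∷ʳ x z as (f ∘ (a ∷_)))))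
  (trans (rearrange (f (x ∷ a ∷ (as ∷ʳ z))) (f (a ∷ ((as ∷ʳ z) ∷ʳ x))) (Σl (insertions x as) (λ w → f (a ∷ (w ∷ʳ z)))))
  (cong (λ q → f (a ∷ ((as ∷ʳ z) ∷ʳ x)) + (f (x ∷ a ∷ (as ∷ʳ z)) + q)) (sym (Σ-map (a ∷_) (insertions x as) (λ w → f (w ∷ʳ z))))))
  where rearrange : ∀ p q r → p + (q + r) ≡ q + (p + r)
        rearrange = solve-∀

take-∷ʳ : ∀ {A : Set} ℓ (w : List A) z → ℓ ℕ.≤ length w → take ℓ (w ∷ʳ z) ≡ take ℓ w
take-∷ʳ zero w z h = refl
take-∷ʳ (suc ℓ) (x ∷ w) z (ℕ.s≤s h) = cong (x ∷_) (take-∷ʳ ℓ w z h)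

flagLengths≤ : ∀ k → All (λ ℓ → ℓ ℕ.≤ k) (L.map suc (upTo k))
flagLengths≤ k = AP.map⁺ (AP.applyUpTo⁺₁ id k (λ i<k → i<k))

smaller-inject₁ : ∀ {k} (y : Fin k) (ys : List (Fin k)) →
  length (L.filter (λ z → z F.<? F.inject₁ y) (L.map F.inject₁ ys ∷ʳ F.fromℕ k)) ≡ length (L.filter (λ z → z F.<? y) ys)
smaller-inject₁ {k} y [] = trans (smaller-∷ (F.inject₁ y) (F.fromℕ k) []) (cong (ℕ._+ 0) (𝟙≡0 (F.fromℕ k F.<? F.inject₁ y)
  (λ h → NP.<-asym h (subst₂ ℕ._<_ (sym (FP.toℕ-inject₁ y)) (sym (FP.toℕ-fromℕ k)) (FP.toℕ<n y)))))
smaller-inject₁ y (z ∷ zs) = trans (smaller-∷ (F.inject₁ y) (F.inject₁ z) _) (trans (cong₂ ℕ._+_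
  (𝟙-resp _ _ (λ h → subst₂ ℕ._<_ (FP.toℕ-inject₁ z) (FP.toℕ-inject₁ y) h) (λ h → subst₂ ℕ._<_ (sym (FP.toℕ-inject₁ z)) (sym (FP.toℕ-inject₁ y)) h))
  (smaller-inject₁ y zs)) (sym (smaller-∷ y z zs)))

inv-∷ʳ : ∀ {k} (ρ : List (Fin k)) → inversions (L.map F.inject₁ ρ ∷ʳ F.fromℕ k) ≡ inversions ρ
inv-∷ʳ [] = refl
inv-∷ʳ (y ∷ ys) = cong₂ ℕ._+_ (smaller-inject₁ y ys) (inv-∷ʳ ys)

δ≢ : ∀ {n} (x y : Vec ℤ n) → x ≢ y → δ x y ≡ 0ℤ
δ≢ x y ne with ≡-dec ℤ._≟_ x y
... | yes e = ⊥-elim (ne e)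
... | no _ = refl

Avoid : ∀ {n} → Fin n → Poly n → Set
Avoid k p = All (λ t → lookup (proj₂ t) k ≡ 0) p

Avoid-*P : ∀ {n} (k : Fin n) (p q : Poly n) → Avoid k p → Avoid k q → Avoid k (p *P q)
Avoid-*P k [] q [] hq = []
Avoid-*P k ((a , e) ∷ p) q (h ∷ hp) hq = AP.++⁺
  (AP.map⁺ (All.map (λ {s} hs → trans (VP.lookup-zipWith ℕ._+_ k e (proj₂ s)) (cong₂ ℕ._+_ h hs)) hq))
  (Avoid-*P k p q hp hq)

Avoid-1P : ∀ {n} (k : Fin n) → Avoid k (1P {n})
Avoid-1P k = VP.lookup-replicate k 0 ∷ []

Avoid-^ : ∀ {n} (k : Fin n) (p : Poly n) i → Avoid k p → Avoid k (p ^P i)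
Avoid-^ k p zero h = Avoid-1P k
Avoid-^ k p (suc i) h = Avoid-*P k p (p ^P i) h (Avoid-^ k p i h)

Avoid-prod : ∀ {n} (k : Fin n) (ps : List (Poly n)) → All (Avoid k) ps → Avoid k (prodP ps)
Avoid-prod k [] [] = Avoid-1P k
Avoid-prod k (p ∷ ps) (h ∷ hs) = Avoid-*P k p (prodP ps) h (Avoid-prod k ps hs)

Avoid-lin : ∀ {n} (k : Fin n) (w : List (Fin n)) → All (λ i → i ≢ k) w → Avoid k (linSum w)
Avoid-lin k w h = subst (Avoid k) (sym (linSum≡ w)) (AP.map⁺ (All.map (λ {i} ne → lookup-unitV≢ i k (λ e → ne (sym e))) h))

⟦⟧-avoid : ∀ {n} (k : Fin n) (p : Poly n) (d : Vec ℤ n) → Avoid k p → lookup d k ≢ + 0 → ⟦ p ⟧ d ≡ 0ℤ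
⟦⟧-avoid k p d h ne = Σ-0A p (All.map (λ {t} ht → trans (cong (proj₁ t *_) (δ≢ _ _
   (λ e → ne (trans (sym (cong (λ v → lookup v k) e)) (trans (lookup-toZ (proj₂ t) k) (cong +_ ht))))))
   (ZP.*-zeroʳ (proj₁ t))) h)

⟦⟧-neg : ∀ {n} (k : Fin n) (p : Poly n) (d : Vec ℤ n) → lookup d k ℤ.< + 0 → ⟦ p ⟧ d ≡ 0ℤ
⟦⟧-neg k p d neg = Σ-0 p (λ t → trans (cong (proj₁ t *_) (δ≢ _ _
   (λ e → ZP.<-irrefl refl (ZP.<-≤-trans neg (subst (+ 0 ≤ℤ_) (trans (sym (lookup-toZ (proj₂ t) k)) (cong (λ v → lookup v k) e)) (ℤ.+≤+ ℕ.z≤n))))))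
   (ZP.*-zeroʳ (proj₁ t)))

flag-∷ʳ : ∀ {n} u (w : List (Fin n)) z ls → All (ℕ._≤ length w) ls → flag u (w ∷ʳ z) ls ≡ flag u w ls
flag-∷ʳ u w z ls h = cong prodP (LP.map-cong-local (All.map (λ {ℓ} ℓ≤ → cong (λ q → linSum q ^P u) (take-∷ʳ ℓ w z ℓ≤)) h))

Avoid-flag : ∀ {n} (k : Fin n) u (w : List (Fin n)) ls → All (λ i → i ≢ k) w → Avoid k (flag u w ls)
Avoid-flag k u w ls h = Avoid-prod k _ (AP.map⁺ (All.universal (λ ℓ → Avoid-^ k _ u (Avoid-lin k _ (AP.take⁺ ℓ h))) ls))

termQ-avoids : ∀ m u (w : List (Fin (suc m))) z → length w ≡ m → All (λ i → i ≢ z) w →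
               Avoid z (termQ (suc m) u 0 (w ∷ʳ z))
termQ-avoids m u w z len h = Avoid-*P z _ 1P
  (subst (Avoid z) (sym (flag-∷ʳ u w z ls (All.map (λ ℓ≤ → subst (_ ℕ.≤_) (sym len) ℓ≤) (flagLengths≤ m))))
    (Avoid-flag z u w ls h))
  (Avoid-1P z)
  where ls = L.map suc (upTo m)

-- The flag product of a rearrangement ρ of all n letters with lengths 1, …, n:
-- the last factor (x_1 + … + x_n)^u is the total power.
flag-full : ∀ m u (ρ : List (Fin (suc m))) → ρ ↭ allFin (suc m) →
            flag u ρ (L.map suc (upTo (suc m))) ≈ termQ (suc m) u u ρ
flag-full m u ρ p d = begin
  ⟦ prodP (L.map g (L.map suc (upTo (suc m)))) ⟧ d  ≡⟨ cong (λ ls → ⟦ prodP (L.map g ls) ⟧ d) lengths ⟩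
  ⟦ prodP (L.map g (ls₀ ∷ʳ suc m)) ⟧ d              ≡⟨ cong (λ z → ⟦ prodP z ⟧ d) (LP.map-++ g ls₀ [ suc m ]) ⟩
  ⟦ prodP (L.map g ls₀ ∷ʳ g (suc m)) ⟧ d            ≡⟨ prodP-∷ʳ (L.map g ls₀) (g (suc m)) d ⟩
  ⟦ prodP (L.map g ls₀) *P g (suc m) ⟧ d             ≡⟨ *-congʳ (prodP (L.map g ls₀)) lastFactor d ⟩
  ⟦ termQ (suc m) u u ρ ⟧ d                          ∎
  where
  open ≡-Reasoning
  ls₀ = L.map suc (upTo m)
  g : ℕ → Poly (suc m)
  g ℓ = linSum (take ℓ ρ) ^P u
  lengths : L.map suc (upTo (suc m)) ≡ ls₀ ∷ʳ suc m
  lengths = trans (cong (L.map suc) (sym (LP.applyUpTo-∷ʳ id m))) (LP.map-++ suc (upTo m) [ m ])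
  lastFactor : g (suc m) ≈ totalPow (suc m) u
  lastFactor = subst (λ w → (linSum w ^P u) ≈ totalPow (suc m) u)
                     (sym (LP.take-all (suc m) ρ (NP.≤-reflexive (trans (PermP.↭-length p) (LP.length-tabulate id)))))
                     (linpow-↭ p u)

rep-∷ʳ : ∀ {A : Set} k (x : A) → replicate (suc k) x ≡ replicate k x V.∷ʳ x
rep-∷ʳ zero x = refl
rep-∷ʳ (suc k) x = cong (x ∷_) (rep-∷ʳ k x)

zip-∷ʳ : ∀ {A B C : Set} {k} (f : A → B → C) (xs : Vec A k) x (ys : Vec B k) y →
  zipWith f (xs V.∷ʳ x) (ys V.∷ʳ y) ≡ zipWith f xs ys V.∷ʳ f x y
zip-∷ʳ f [] x [] y = refl
zip-∷ʳ f (a ∷ xs) x (b ∷ ys) y = cong (f a b ∷_) (zip-∷ʳ f xs x ys y)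

unit-inject₁ : ∀ {k} (i : Fin k) → unitV (F.inject₁ i) ≡ unitV i V.∷ʳ 0
unit-inject₁ {suc k} F.zero = cong (1 ∷_) (rep-∷ʳ k 0)
unit-inject₁ {suc k} (F.suc i) = cong (0 ∷_) (unit-inject₁ i)

module Emb {k : ℕ} where
  open ExponentMap (V._∷ʳ 0) F.inject₁ (λ e f → sym (zip-∷ʳ ℕ._+_ e 0 f 0)) (sym (rep-∷ʳ k 0)) (λ i → sym (unit-inject₁ i)) public
    renaming (mapP to emb; mapTerm to embTerm; mapP-flag to emb-flag)

  ⟦emb⟧ : ∀ p (d : Vec ℤ k) → ⟦ emb p ⟧ (d V.∷ʳ + 0) ≡ ⟦ p ⟧ d
  ⟦emb⟧ p d = trans (Σ-map embTerm p _) (Σ-cong p (λ t → cong (proj₁ t *_) (δ-resp _ _ _ _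
    (λ h → VP.∷ʳ-injectiveˡ _ _ (trans (sym (VP.map-∷ʳ _ 0 (proj₂ t))) h))
    (λ h → trans (VP.map-∷ʳ _ 0 (proj₂ t)) (cong (V._∷ʳ + 0) h)))))

Decreasing : ∀ {n} → Vec ℤ n → Set
Decreasing {zero} d = ⊤
Decreasing {suc m} d = ∀ (j : Fin m) → lookup d (F.suc j) ℤ.< lookup d (F.inject₁ j)

decreasing? : ∀ {n} (d : Vec ℤ n) → Dec (Decreasing d)
decreasing? {zero} d = yes tt
decreasing? {suc m} d = FP.all? (λ j → lookup d (F.suc j) ZP.<? lookup d (F.inject₁ j))

last≤ : ∀ {m} (d : Vec ℤ (suc m)) → Decreasing d → ∀ k → lookup d (F.fromℕ m) ≤ℤ lookup d k
last≤ {zero} (x ∷ []) sd F.zero = ZP.≤-refl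
last≤ {suc m} (x ∷ d) sd F.zero = ZP.≤-trans (last≤ d (λ j → sd (F.suc j)) F.zero) (ZP.<⇒≤ (sd F.zero))
last≤ {suc m} (x ∷ d) sd (F.suc k) = last≤ d (λ j → sd (F.suc j)) k

last< : ∀ {m} (d : Vec ℤ (suc m)) → Decreasing d → ∀ k → lookup d (F.fromℕ m) ℤ.< lookup d (F.inject₁ k)
last< d sd k = ZP.≤-<-trans (last≤ d sd (F.suc k)) (sd k)

lookup-∷ʳ-inject₁ : ∀ {A : Set} {k} (d : Vec A k) x (i : Fin k) → lookup (d V.∷ʳ x) (F.inject₁ i) ≡ lookup d i
lookup-∷ʳ-inject₁ (y ∷ d) x F.zero = refl
lookup-∷ʳ-inject₁ (y ∷ d) x (F.suc i) = lookup-∷ʳ-inject₁ d x i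

lookup-∷ʳ-last : ∀ {A : Set} {k} (d : Vec A k) x → lookup (d V.∷ʳ x) (F.fromℕ k) ≡ x
lookup-∷ʳ-last [] x = refl
lookup-∷ʳ-last (y ∷ d) x = lookup-∷ʳ-last d x

decreasing-init : ∀ {m} (d : Vec ℤ (suc m)) x → Decreasing (d V.∷ʳ x) → Decreasing d
decreasing-init {zero} d x sd = λ ()
decreasing-init {suc m} d x sd j = subst₂ ℤ._<_ (lookup-∷ʳ-inject₁ d x (F.suc j)) (lookup-∷ʳ-inject₁ d x (F.inject₁ j)) (sd (F.inject₁ j))

occ-++ : ∀ {n} (c : Fin n) xs ys → occ c (xs ++ ys) ≡ occ c xs ℕ.+ occ c ys
occ-++ c [] ys = refl
occ-++ c (x ∷ xs) ys = trans (cong (𝟙 (x F.≟ c) ℕ.+_) (occ-++ c xs ys)) (sym (NP.+-assoc (𝟙 (x F.≟ c)) _ _))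

occ≡0 : ∀ {n} (c : Fin n) xs → occ c xs ≡ 0 → All (λ i → i ≢ c) xs
occ≡0 c [] h = []
occ≡0 c (x ∷ xs) h with x F.≟ c
... | yes _ = ⊥-elim (NP.1+n≢0 h)
... | no ne = ne ∷ occ≡0 c xs h

occ-map-inject₁ : ∀ {k} (c : Fin k) xs → occ (F.inject₁ c) (L.map F.inject₁ xs) ≡ occ c xs
occ-map-inject₁ c [] = refl
occ-map-inject₁ c (x ∷ xs) = cong₂ ℕ._+_ (𝟙-resp _ _ FP.inject₁-injective (cong F.inject₁)) (occ-map-inject₁ c xs)

last∉init : ∀ {n} (ys : List (Fin n)) y → occ y (ys ∷ʳ y) ≡ 1 → occ y ys ≡ 0
last∉init ys y h = NP.+-cancelʳ-≡ 1 (occ y ys) 0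
  (trans (sym (trans (occ-++ y ys [ y ]) (cong (λ c → occ y ys ℕ.+ (c ℕ.+ 0)) (𝟙≡1 (y F.≟ y) refl)))) h)

-- A
-- permutation of Fin (m+2) is a permutation ρ of Fin (m+1), seen through
-- inject₁, with the last letter inserted somewhere.
module PeelLast (m u : ℕ) where
  lst : Fin (suc (suc m))
  lst = F.fromℕ (suc m)

  summand : Vec ℤ (suc (suc m)) → List (Fin (suc (suc m))) → ℤ
  summand d π = sgn π * ⟦ termQ (suc (suc m)) u 0 π ⟧ d

  length-perm : ∀ {ρ : List (Fin (suc m))} → ρ ↭ allFin (suc m) → length ρ ≡ suc m
  length-perm p = trans (PermP.↭-length p) (LP.length-tabulate id)

  summand-avoid : ∀ d π k → Avoid k (termQ (suc (suc m)) u 0 π) → lookup d k ≢ + 0 → summand d π ≡ 0ℤ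
  summand-avoid d π k h nz = trans (cong (sgn π *_) (⟦⟧-avoid k _ d h nz)) (ZP.*-zeroʳ (sgn π))

  coeffQ-byInsertion : ∀ d → coeffQ (suc (suc m)) u 0 d ≡ Σl (Sym (suc m)) (λ ρ → Σl (insertions lst (L.map F.inject₁ ρ)) (summand d))
  coeffQ-byInsertion d = trans (Σ-perms-↭ reorder (summand d))
    (trans (Σ-concatMap (insertions lst) (perms (L.map F.inject₁ (allFin (suc m)))) (summand d))
           (Σ-perms-map F.inject₁ (allFin (suc m)) (λ ρ → Σl (insertions lst ρ) (summand d))))
    where reorder : allFin (suc (suc m)) ↭ lst ∷ L.map F.inject₁ (allFin (suc m))
          reorder = subst (_↭ lst ∷ L.map F.inject₁ (allFin (suc m))) (sym (allFin-∷ʳ (suc m))) (↭-sym (PermP.∷↭∷ʳ lst _))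

  -- If d is decreasing with d_last ≥ 0, only the insertion of the last letter
  -- at the end contributes: any other word ends in a letter y with d_y > 0
  -- that its summand does not involve.
  insertion-atEnd : ∀ d → + 0 ≤ℤ lookup d lst → Decreasing d → ∀ ρ → ρ ↭ allFin (suc m) →
          Σl (insertions lst (L.map F.inject₁ ρ)) (summand d) ≡ summand d (L.map F.inject₁ ρ ∷ʳ lst)
  insertion-atEnd d d≥0 sd ρ pρ with L.initLast ρ
  ... | [] = ⊥-elim (NP.0≢1+n (length-perm pρ))
  ... | ys L.∷ʳ′ y = begin
    Σl (insertions lst (L.map F.inject₁ (ys ∷ʳ y))) (summand d)
      ≡⟨ cong (λ r → Σl (insertions lst r) (summand d)) split ⟩
    Σl (insertions lst (ỹs ∷ʳ ỹ)) (summand d)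
      ≡⟨ Σ-insertions-∷ʳ lst ỹ ỹs (summand d) ⟩
    summand d ((ỹs ∷ʳ ỹ) ∷ʳ lst) + Σl (insertions lst ỹs) (λ w → summand d (w ∷ʳ ỹ))
      ≡⟨ cong (λ q → summand d ((ỹs ∷ʳ ỹ) ∷ʳ lst) + q) (Σ-0A _ (All.map (λ {w} → notAtEnd w) (ins↭ lst ỹs))) ⟩
    summand d ((ỹs ∷ʳ ỹ) ∷ʳ lst) + 0ℤ
      ≡⟨ trans (ZP.+-identityʳ _) (cong (λ r → summand d (r ∷ʳ lst)) (sym split)) ⟩
    summand d (L.map F.inject₁ (ys ∷ʳ y) ∷ʳ lst) ∎
    where
    open ≡-Reasoning
    ỹs = L.map F.inject₁ ys
    ỹ = F.inject₁ y
    split : L.map F.inject₁ (ys ∷ʳ y) ≡ ỹs ∷ʳ ỹ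
    split = LP.map-++ F.inject₁ ys [ y ]
    y∉ys : occ y ys ≡ 0
    y∉ys = last∉init ys y (trans (occ-↭ y pρ) (occ-allFin y))
    d-ỹ≢0 : lookup d ỹ ≢ + 0
    d-ỹ≢0 e = ZP.<-irrefl (sym e) (ZP.≤-<-trans d≥0 (last< d sd y))
    notAtEnd : ∀ w → w ↭ lst ∷ ỹs → summand d (w ∷ʳ ỹ) ≡ 0ℤ
    notAtEnd w pw = summand-avoid d (w ∷ʳ ỹ) ỹ (termQ-avoids (suc m) u w ỹ length-w ỹ∉w) d-ỹ≢0
      where
      length-w : length w ≡ suc m
      length-w = trans (PermP.↭-length pw) (cong suc (trans (LP.length-map F.inject₁ ys)
                   (NP.suc-injective (trans (NP.+-comm 1 _) (trans (sym (LP.length-++ ys)) (length-perm pρ))))))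
      ỹ∉w : All (λ i → i ≢ ỹ) w
      ỹ∉w = occ≡0 ỹ w (trans (occ-↭ ỹ pw)
               (cong₂ ℕ._+_ (𝟙≡0 (lst F.≟ ỹ) FP.fromℕ≢inject₁) (trans (occ-map-inject₁ y ys) y∉ys)))

  coeffQ-atEnd : ∀ d → + 0 ≤ℤ lookup d lst → Decreasing d →
                 coeffQ (suc (suc m)) u 0 d ≡ Σl (Sym (suc m)) (λ ρ → summand d (L.map F.inject₁ ρ ∷ʳ lst))
  coeffQ-atEnd d d≥0 sd = trans (coeffQ-byInsertion d) (Σ-perms-cong (allFin (suc m)) (insertion-atEnd d d≥0 sd))

  atEnd-avoids : ∀ ρ → ρ ↭ allFin (suc m) → Avoid lst (termQ (suc (suc m)) u 0 (L.map F.inject₁ ρ ∷ʳ lst))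
  atEnd-avoids ρ pρ = termQ-avoids (suc m) u (L.map F.inject₁ ρ) lst
      (trans (LP.length-map F.inject₁ ρ) (length-perm pρ))
      (AP.map⁺ (All.universal (λ i e → FP.fromℕ≢inject₁ (sym e)) ρ))

  atEnd-reduces : ∀ (d' : Vec ℤ (suc m)) ρ → ρ ↭ allFin (suc m) →
          summand (d' V.∷ʳ + 0) (L.map F.inject₁ ρ ∷ʳ lst) ≡ sgn ρ * ⟦ termQ (suc m) u u ρ ⟧ d'
  atEnd-reduces d' ρ pρ = cong₂ _*_ (cong (-1ℤ ℤ.^_) (inv-∷ʳ ρ)) (begin
      ⟦ flag u ρ̃l ls *P 1P ⟧ (d' V.∷ʳ + 0)  ≡⟨ *-unitʳ (flag u ρ̃l ls) _ ⟩
      ⟦ flag u ρ̃l ls ⟧ (d' V.∷ʳ + 0)        ≡⟨ cong (λ z → ⟦ z ⟧ (d' V.∷ʳ + 0)) dropLast ⟩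
      ⟦ emb (flag u ρ ls) ⟧ (d' V.∷ʳ + 0)   ≡⟨ ⟦emb⟧ (flag u ρ ls) d' ⟩
      ⟦ flag u ρ ls ⟧ d'                    ≡⟨ flag-full m u ρ pρ d' ⟩
      ⟦ termQ (suc m) u u ρ ⟧ d'            ∎)
    where
    open ≡-Reasoning
    open Emb {suc m}
    ρ̃l = L.map F.inject₁ ρ ∷ʳ lst
    ls = L.map suc (upTo (suc m))
    dropLast : flag u ρ̃l ls ≡ emb (flag u ρ ls)
    dropLast = trans (flag-∷ʳ u (L.map F.inject₁ ρ) lst ls
                       (All.map (λ ℓ≤ → subst (_ ℕ.≤_) (sym (trans (LP.length-map F.inject₁ ρ) (length-perm pρ))) ℓ≤) (flagLengths≤ (suc m))))
                     (sym (emb-flag u ρ ls))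

base-v0 : ∀ m u (d : Vec ℤ (suc (suc m))) → Decreasing d →
          (∀ (d' : Vec ℤ (suc m)) → Decreasing d' → + 0 ≤ℤ coeffQ (suc m) u u d') →
          + 0 ≤ℤ coeffQ (suc (suc m)) u 0 d
base-v0 m u d sd IH with ZP.<-cmp (lookup d lst) (+ 0)
  where open PeelLast m u
... | tri< neg _ _ = ZP.≤-reflexive (sym (Σ-0 (Sym (suc (suc m)))
        (λ π → trans (cong (sgn π *_) (⟦⟧-neg lst (termQ (suc (suc m)) u 0 π) d neg)) (ZP.*-zeroʳ (sgn π)))))
  where open PeelLast m u
... | tri> _ _ pos = ZP.≤-reflexive (sym (trans (coeffQ-atEnd d (ZP.<⇒≤ pos) sd)
        (Σ-perms-0 (allFin (suc m)) (λ ρ pρ → summand-avoid d _ lst (atEnd-avoids ρ pρ) (λ e → ZP.<-irrefl (sym e) pos)))))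
  where open PeelLast m u
... | tri≈ _ last≡0 _ with V.initLast d
...   | d' , y , refl = subst (+ 0 ≤ℤ_) (sym reduce) (IH d' (decreasing-init d' y sd))
  where
  open PeelLast m u
  y≡0 : y ≡ + 0
  y≡0 = trans (sym (lookup-∷ʳ-last d' y)) last≡0
  reduce : coeffQ (suc (suc m)) u 0 (d' V.∷ʳ y) ≡ coeffQ (suc m) u u d'
  reduce = trans (coeffQ-atEnd _ (ZP.≤-reflexive (sym last≡0)) sd)
    (Σ-perms-cong (allFin (suc m)) (λ ρ pρ →
      trans (cong (λ q → summand (d' V.∷ʳ q) (L.map F.inject₁ ρ ∷ʳ lst)) y≡0) (atEnd-reduces d' ρ pρ)))

nonneg-* : ∀ {x y : ℤ} → + 0 ≤ℤ x → + 0 ≤ℤ y → + 0 ≤ℤ x * y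
nonneg-* {+ k} {+ l} _ _ = subst (+ 0 ≤ℤ_) (ZP.pos-* k l) (ℤ.+≤+ ℕ.z≤n)

⟦⟧-nonneg : ∀ {n} (p : Poly n) d → All (λ t → + 0 ≤ℤ proj₁ t) p → + 0 ≤ℤ ⟦ p ⟧ d
⟦⟧-nonneg [] d [] = ZP.≤-refl
⟦⟧-nonneg (t ∷ p) d (h ∷ hs) = ZP.+-mono-≤ (nonneg-* h (δ-nonneg (toZ (proj₂ t)) d)) (⟦⟧-nonneg p d hs)

base-n1 : ∀ u (d : Vec ℤ 1) → + 0 ≤ℤ coeffQ 1 u 0 d
base-n1 u d = subst (+ 0 ≤ℤ_) (sym (trans (ZP.+-identityʳ _) (ZP.*-identityˡ X))) (⟦⟧-nonneg (1P *P 1P) d (ℤ.+≤+ ℕ.z≤n ∷ []))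
  where X = ⟦ 1P {1} *P 1P ⟧ d

-- Subtracting a unit vector keeps a decreasing vector weakly
-- decreasing, and a weakly decreasing vector is either decreasing or has a tie
-- between adjacent entries, where coeffQ vanishes.

lookup-⊖ : ∀ {n} (d e : Vec ℤ n) (i : Fin n) → lookup (d ⊖ e) i ≡ lookup d i - lookup e i
lookup-⊖ d e i = VP.lookup-zipWith _-_ i d e

ê-bounds : ∀ {n} (j i : Fin n) → (+ 0 ≤ℤ lookup (ê j) i) × (lookup (ê j) i ≤ℤ + 1)
ê-bounds j i with i F.≟ j
... | yes refl rewrite lookup-toZ (unitV j) j | lookup-unitV≡ j = ℤ.+≤+ ℕ.z≤n , ZP.≤-refl
... | no ne rewrite lookup-toZ (unitV j) i | lookup-unitV≢ j i ne = ZP.≤-refl , ℤ.+≤+ ℕ.z≤n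

shift-≤ : ∀ x y a b → x ℤ.< y → + 0 ≤ℤ a → b ≤ℤ + 1 → x - a ≤ℤ y - b
shift-≤ x y a b x<y 0≤a b≤1 = begin
  x - a ≤⟨ ZP.+-monoʳ-≤ x (ZP.neg-mono-≤ 0≤a) ⟩
  x + - + 0 ≡⟨ ZP.+-identityʳ x ⟩
  x ≡⟨ suc-pred x ⟩
  (ℤ.suc x) + ℤ.-1ℤ ≤⟨ ZP.+-monoˡ-≤ ℤ.-1ℤ (ZP.i<j⇒suc[i]≤j x<y) ⟩
  y + ℤ.-1ℤ ≤⟨ ZP.+-monoʳ-≤ y (ZP.neg-mono-≤ b≤1) ⟩
  y - b ∎
  where open ZP.≤-Reasoning
        suc-pred : ∀ x → x ≡ (1ℤ + x) + ℤ.-1ℤ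
        suc-pred = solve-∀

shift-weaklyDecreasing : ∀ {m} (d : Vec ℤ (suc m)) → Decreasing d → ∀ j k →
  lookup (d ⊖ ê j) (F.suc k) ≤ℤ lookup (d ⊖ ê j) (F.inject₁ k)
shift-weaklyDecreasing d sd j k rewrite lookup-⊖ d (ê j) (F.suc k) | lookup-⊖ d (ê j) (F.inject₁ k) =
  shift-≤ _ _ _ _ (sd k) (proj₁ (ê-bounds j (F.suc k))) (proj₂ (ê-bounds j (F.inject₁ k)))

decreasing⊎tie : ∀ {m} (d : Vec ℤ (suc m)) → (∀ k → lookup d (F.suc k) ≤ℤ lookup d (F.inject₁ k)) →
                 Decreasing d ⊎ ∃ λ k → lookup d (F.inject₁ k) ≡ lookup d (F.suc k)
decreasing⊎tie {m} d weak with decreasing? d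
... | yes sd = inj₁ sd
... | no ¬sd with FP.¬∀⟶∃¬ m _ (λ k → lookup d (F.suc k) ZP.<? lookup d (F.inject₁ k)) ¬sd
...   | k , ¬< = inj₂ (k , ZP.≤-antisym (ZP.≮⇒≥ ¬<) (weak k))

coeffQ-nonneg : ∀ m u v (d : Vec ℤ (suc m)) → Decreasing d → + 0 ≤ℤ coeffQ (suc m) u v d
coeffQ-nonneg m u (suc v) d sd =
  subst (+ 0 ≤ℤ_) (sym (coeffQ-suc (suc m) u v d)) (Σ-nonneg (allFin (suc m)) _ shifted)
  where
  shifted : ∀ j → + 0 ≤ℤ coeffQ (suc m) u v (d ⊖ ê j)
  shifted j with decreasing⊎tie (d ⊖ ê j) (shift-weaklyDecreasing d sd j)
  ... | inj₁ sd' = coeffQ-nonneg m u v (d ⊖ ê j) sd'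
  ... | inj₂ (k , tie) = ZP.≤-reflexive (sym (coeffQ-vanishes m u v (d ⊖ ê j) k tie))
coeffQ-nonneg zero u zero d sd = base-n1 u d
coeffQ-nonneg (suc m) u zero d sd = base-v0 m u d sd (coeffQ-nonneg m u u)

decreasing-toZ : ∀ {m} (d : Vec ℕ (suc m)) → (∀ (i j : Fin (suc m)) → i <F j → lookup d j < lookup d i) →
                 Decreasing (toZ d)
decreasing-toZ d h j = subst₂ ℤ._<_ (sym (lookup-toZ d (F.suc j))) (sym (lookup-toZ d (F.inject₁ j)))
  (ℤ.+<+ (h (F.inject₁ j) (F.suc j) (NP.≤-reflexive (cong suc (FP.toℕ-inject₁ j)))))

lemma4 : (n u v : ℕ) → n ≥ 1 → (d : Vec ℕ n) →
    (∀ (i j : Fin n) → i <F j → lookup d j < lookup d i) →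
    + 0 ≤ℤ α n u v d
lemma4 (suc m) u v _ d h =
  subst (+ 0 ≤ℤ_) (sym (α≡coeffQ (suc m) u v d)) (coeffQ-nonneg m u v (toZ d) (decreasing-toZ d h))
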